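{- $\mathcal{PH}^{cc} \subseteq \mathcal{BP}\cdot\mathcal{PP}^{cc}$; that is, every language in the communication polynomial hierarchy belongs to the class obtained by applying the BP-operator to the communication class $\mathcal{PP}^{cc}$.
   Context: Let $\mathbb{B}=\{0,1\}$. A language is a set $L\subseteq\{(x,y)\mid x,y\in\mathbb{B}^*,|x|=|y|\}$; its $n$-bit section $L_n$ is the set of $(x,y)\in L$ with $x,y\in\mathbb{B}^n$, viewed also as the Boolean function on $\mathbb{B}^n\times\mathbb{B}^n$ (or $2^n\times 2^n$ Boolean matrix) with value 1 exactly on $L_n$. "$\mathrm{polylog}(n)$" means bounded by $(\log n)^{O(1)}$. Guess protocols and $\mathcal{PP}^{cc}$: a guess protocol $\Pi=(\Pi_1,\dots,\Pi_l)$ over $X\times Y$ is a finite sequence of deterministic two-party (Yao-model) protocols with output in $\mathbb{B}$; it uses $l$ guesses. $\mathrm{acc}_\Pi(x,y)=|\{i: f_{\Pi_i}(x,y)=1\}|$, $\mathrm{rej}_\Pi(x,y)=l-\mathrm{acc}_\Pi(x,y)$, where $f_{\Pi_i}$ is the function computed by $\Pi_i$. $\Pi$ computes $f$ in PP acceptance mode if $f(x,y)=1\iff \mathrm{acc}_\Pi(x,y)>\mathrm{rej}_\Pi(x,y)$. The cost of $\Pi$ is $\lceil\log l\rceil+\max_i D(\Pi_i)$, $D(\Pi_i)$ the worst-case communication of $\Pi_i$. $\mathrm{PP}(f)$ is the minimum cost of a guess protocol computing $f$ in PP acceptance mode, and $\mathcal{PP}^{cc}=\{L\mid \mathrm{PP}(L_n)=\mathrm{polylog}(n)\}$.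 BP-operator on classes: for a class $\mathcal{C}$ of languages, $L\in\mathcal{BP}\cdot\mathcal{C}$ iff there exist $L'\in\mathcal{C}$ and a polynomially bounded function $q$ such that for all $n$ and all $x,y\in\mathbb{B}^n$, with $m=\lceil q(\log n)\rceil$, the fraction of $r\in\mathbb{B}^m$ with $(\langle x,r\rangle,\langle y,r\rangle)\in L'$ is at most $1/3$ if $(x,y)\notin L$ and at least $2/3$ if $(x,y)\in L$; here $\langle\cdot,\cdot\rangle$ is a fixed pairing function on strings. $\mathcal{PH}^{cc}$: $L\in\mathcal{PH}^{cc}$ iff there exist a constant $k$ and a function $s(n)\le 2^{\mathrm{polylog}(n)}$ such that for every $n$, $L_n=\bigcup_{u_1}\bigcap_{u_2}\bigcup_{u_3}\cdots (A_{u_1\dots u_k}\times B_{u_1\dots u_k})$ with $k$ alternating unions/intersections, each index $u_i$ ranging over a set of size at most $s(n)$, and each $A_{u_1\dots u_k},B_{u_1\dots u_k}\subseteq\mathbb{B}^n$ (i.e. combinatorial rectangles at the bottom). -}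

module Defs where

open import Data.Bool using (Bool; true; false; _∧_; if_then_else_)
open import Data.Nat using (ℕ; zero; suc; _+_; _*_; _^_; _≤_; _<_; _∸_; _⊔_)
open import Data.Nat.Logarithm using (⌈log₂_⌉)
open import Data.Fin using (Fin)
open import Data.Vec using (Vec; []; _∷_; _++_)
open import Data.List using (List; []; _∷_; length)
open import Data.Vec.Relation.Unary.All using (All)
open import Data.Unit using (⊤; tt)
open import Data.Product using (Σ; ∃; _×_; _,_)
open import Relation.Binary.PropositionalEquality using (_≡_)
open import Function.Bundles using (_⇔_)

-- A language is represented by the family of its n-bit sections
-- L_n : 𝔹ⁿ × 𝔹ⁿ → 𝔹  (pairs of unequal length are never in a language).
Language : Set
Language = (n : ℕ) → Vec Bool n → Vec Bool n → Bool

plog : ℕ → ℕ → ℕ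
plog c n = (2 + ⌈log₂ n ⌉) ^ c

PolyLog : (ℕ → ℕ) → Set
PolyLog f = ∃ λ c → ∀ n → f n ≤ plog c n

QuasiPoly : (ℕ → ℕ) → Set
QuasiPoly s = ∃ λ c → ∀ n → s n ≤ 2 ^ plog c n

data Protocol (X Y : Set) : Set where
  leaf  : Bool → Protocol X Y
  alice : (X → Bool) → Protocol X Y → Protocol X Y → Protocol X Y
  bob   : (Y → Bool) → Protocol X Y → Protocol X Y → Protocol X Y

run : ∀ {X Y} → Protocol X Y → X → Y → Bool
run (leaf b)      x y = b
run (alice f l r) x y = if f x then run r x y else run l x y
run (bob g l r)   x y = if g y then run r x y else run l x y

-- worst-case communication = depth of the protocol tree
depth : ∀ {X Y} → Protocol X Y → ℕ
depth (leaf _)      = 0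
depth (alice _ l r) = suc (depth l ⊔ depth r)
depth (bob _ l r)   = suc (depth l ⊔ depth r)

GuessProtocol : Set → Set → Set
GuessProtocol X Y = List (Protocol X Y)

acc : ∀ {X Y} → GuessProtocol X Y → X → Y → ℕ
acc []       x y = 0
acc (p ∷ ps) x y = (if run p x y then 1 else 0) + acc ps x y

rej : ∀ {X Y} → GuessProtocol X Y → X → Y → ℕ
rej Π x y = length Π ∸ acc Π x y

maxDepth : ∀ {X Y} → GuessProtocol X Y → ℕ
maxDepth []       = 0
maxDepth (p ∷ ps) = depth p ⊔ maxDepth ps

cost : ∀ {X Y} → GuessProtocol X Y → ℕ
cost Π = ⌈log₂ length Π ⌉ + maxDepth Π

ComputesPP : ∀ {X Y} → GuessProtocol X Y → (X → Y → Bool) → Set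
ComputesPP Π f = ∀ x y → (f x y ≡ true) ⇔ (rej Π x y < acc Π x y)

PPcc : Language → Set
PPcc L = ∃ λ c → ∀ n → Σ (GuessProtocol (Vec Bool n) (Vec Bool n)) λ Π →
           ComputesPP Π (L n) × cost Π ≤ plog c n

dblLen : ℕ → ℕ
dblLen zero    = zero
dblLen (suc n) = suc (suc (dblLen n))

dbl : ∀ {n} → Vec Bool n → Vec Bool (dblLen n)
dbl []      = []
dbl (b ∷ v) = b ∷ b ∷ dbl v

pair : ∀ {n m} → Vec Bool n → Vec Bool m → Vec Bool (dblLen n + suc (suc m))
pair x r = dbl x ++ (false ∷ true ∷ r)

countTrue : (m : ℕ) → (Vec Bool m → Bool) → ℕ
countTrue zero    P = if P [] then 1 else 0
countTrue (suc m) P = countTrue m (λ r → P (false ∷ r)) + countTrue m (λ r → P (true ∷ r))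

BP : (Language → Set) → Language → Set
BP C L = Σ Language λ L' → C L' × Σ (ℕ → ℕ) λ m → PolyLog m ×
  (∀ n (x y : Vec Bool n) →
     let k = countTrue (m n) (λ r → L' _ (pair x r) (pair y r)) in
     (L n x y ≡ false → 3 * k ≤ 2 ^ m n) ×
     (L n x y ≡ true  → 2 * 2 ^ m n ≤ 3 * k))

Tuple : ∀ {k} → Vec ℕ k → Set
Tuple []       = ⊤
Tuple (t ∷ ts) = Fin t × Tuple ts

-- alternating ⋃_{u₁} ⋂_{u₂} ⋃_{u₃} … ; the Bool flag says whether the
-- outermost operator is a union (true) or an intersection (false)
Alt : ∀ {k} (ts : Vec ℕ k) → Bool → (Tuple ts → Bool) → Set
Alt []       _     P = P tt ≡ true
Alt (t ∷ ts) true  P = ∃ λ (u : Fin t) → Alt ts false (λ us → P (u , us))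
Alt (t ∷ ts) false P = ∀ (u : Fin t) → Alt ts true (λ us → P (u , us))

PHcc : Language → Set
PHcc L = ∃ λ k → Σ (ℕ → ℕ) λ s → QuasiPoly s ×
  (∀ n → Σ (Vec ℕ k) λ ts → All (_≤ s n) ts ×
     Σ (Tuple ts → Vec Bool n → Bool) λ A →
     Σ (Tuple ts → Vec Bool n → Bool) λ B →
       ∀ x y → (L n x y ≡ true) ⇔ Alt ts true (λ u → A u x ∧ B u y))

module Submission where

-- For each n, a language in PHᶜᶜ is an alternating formula of constant depth k
-- over rectangles whose gates have fan-in 2^polylog(n); index the inputs of a
-- gate by p = polylog(n) bits. Arithmetize the formula over ℤ in the manner of
-- Valiant–Vazirani and Toda: an OR gate with 0/1 inputs z_v becomes
-- 1 − ∏_trials ∏_prefixes (1 − ∑_{v surviving the prefix} z_v), each trial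
-- hashing 𝔹ᵖ with p + 1 random affine hyperplanes, and an AND gate is the dual.
-- A trial isolates a single 1 with probability ≥ 1/8 (second moment method),
-- so with T = 6 (k (p + 1) + 2) trials a union bound over the ≤ 2^{k (p + 1)}
-- gates shows that the polynomial agrees with the formula for at least 2/3 of
-- the random strings. The polynomial is a signed sum of 2^polylog(n)
-- rectangles, and such a sum is decided by a PP guess protocol with two guesses
-- of depth ≤ 2 per term accepting exactly when the sum is positive; giving the
-- random string to both players puts L in BP·PPᶜᶜ.

open import Defs
open import Algebra.Bundles using (CommutativeRing)
open import Data.Bool using (Bool; true; false; not; _∧_; _∨_; _xor_; if_then_else_)
import Data.Bool.Properties as Boolₚ
open import Data.Empty using (⊥-elim)
open import Data.Fin using (Fin; toℕ; fromℕ<)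
import Data.Fin.Properties as Finₚ
open import Data.Integer as ℤ using (ℤ; 0ℤ; 1ℤ)
import Data.Integer.Properties as ℤₚ
import Data.Integer.Tactic.RingSolver as ℤ-Solver
open import Data.List using (List; []; _∷_; length; map) renaming (_++_ to _++ᴸ_)
open import Data.List.Properties using (length-map; length-++)
open import Data.Maybe using (Maybe; just; nothing)
open import Data.Nat
  using (ℕ; zero; suc; _+_; _*_; _^_; _∸_; _≤_; _<_; z≤n; s≤s; s≤s⁻¹; _≡ᵇ_; _<ᵇ_; _≟_; _<?_; _≤?_; NonZero; >-nonZero)
open import Data.Nat.Logarithm using (⌈log₂_⌉; ⌈log₂⌉-mono-≤; ⌈log₂2^n⌉≡n)
open import Data.Nat.Properties
open import Data.Nat.Tactic.RingSolver using (solve-∀)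
open import Data.Product using (Σ; ∃; _×_; _,_; proj₁; proj₂)
open import Data.Sum using (_⊎_; inj₁; inj₂)
open import Data.Unit using (tt)
open import Data.Vec using (Vec; []; _∷_; _++_; take; drop)
open import Data.Vec.Properties using (take++drop≡id; ++-injective; ≡-dec)
open import Data.Vec.Relation.Unary.All using (All; []; _∷_)
import Data.Vec.Relation.Unary.All as All
open import Function using (_∘_)
open import Function.Bundles using (_⇔_; mk⇔; Equivalence)
import Function.Properties.Equivalence as ⇔
open import Relation.Binary.Definitions using (tri<; tri≈; tri>)
open import Relation.Binary.PropositionalEquality
open import Relation.Nullary using (Dec; yes; no; contradiction)


𝟙 : Bool → ℕ
𝟙 true = 1
𝟙 false = 0

𝟙≤1 : ∀ b → 𝟙 b ≤ 1
𝟙≤1 true = s≤s z≤n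
𝟙≤1 false = z≤n

𝟙-∧ : ∀ a b → 𝟙 (a ∧ b) ≡ 𝟙 a * 𝟙 b
𝟙-∧ true b = sym (+-identityʳ (𝟙 b))
𝟙-∧ false b = refl

𝟙-∨ : ∀ a b → 𝟙 (a ∨ b) ≤ 𝟙 a + 𝟙 b
𝟙-∨ true b = s≤s z≤n
𝟙-∨ false b = ≤-refl

𝟙+𝟙-not : ∀ b → 𝟙 b + 𝟙 (not b) ≡ 1
𝟙+𝟙-not true = refl
𝟙+𝟙-not false = refl

𝟙-idem : ∀ b → 𝟙 b * 𝟙 b ≡ 𝟙 b
𝟙-idem true = refl
𝟙-idem false = refl

∧-interchange : ∀ a b c d → (a ∧ b) ∧ (c ∧ d) ≡ (a ∧ c) ∧ (b ∧ d)
∧-interchange true b true d = refl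
∧-interchange true b false d = Boolₚ.∧-zeroʳ b
∧-interchange false b c d = refl

take-++ : ∀ {A : Set} {a b} (u : Vec A a) (v : Vec A b) → take a (u ++ v) ≡ u
take-++ {a = a} u v = proj₁ (++-injective (take a (u ++ v)) u (take++drop≡id a (u ++ v)))

drop-++ : ∀ {A : Set} {a b} (u : Vec A a) (v : Vec A b) → drop a (u ++ v) ≡ v
drop-++ {a = a} u v = proj₂ (++-injective (take a (u ++ v)) u (take++drop≡id a (u ++ v)))

∑ : (m : ℕ) → (Vec Bool m → ℕ) → ℕ
∑ zero f = f []
∑ (suc m) f = ∑ m (λ r → f (false ∷ r)) + ∑ m (λ r → f (true ∷ r))

∑-cong : ∀ m {f g : Vec Bool m → ℕ} → (∀ r → f r ≡ g r) → ∑ m f ≡ ∑ m g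
∑-cong zero e = e []
∑-cong (suc m) e = cong₂ _+_ (∑-cong m (λ r → e (false ∷ r))) (∑-cong m (λ r → e (true ∷ r)))

∑-mono-≤ : ∀ m {f g : Vec Bool m → ℕ} → (∀ r → f r ≤ g r) → ∑ m f ≤ ∑ m g
∑-mono-≤ zero e = e []
∑-mono-≤ (suc m) e = +-mono-≤ (∑-mono-≤ m (λ r → e (false ∷ r))) (∑-mono-≤ m (λ r → e (true ∷ r)))

∑-distrib-+ : ∀ m (f g : Vec Bool m → ℕ) → ∑ m (λ r → f r + g r) ≡ ∑ m f + ∑ m g
∑-distrib-+ zero f g = refl
∑-distrib-+ (suc m) f g =
  trans (cong₂ _+_ (∑-distrib-+ m (λ r → f (false ∷ r)) (λ r → g (false ∷ r)))
                   (∑-distrib-+ m (λ r → f (true ∷ r)) (λ r → g (true ∷ r))))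
        (+-+-interchange (∑ m (λ r → f (false ∷ r))) (∑ m (λ r → g (false ∷ r)))
                         (∑ m (λ r → f (true ∷ r))) (∑ m (λ r → g (true ∷ r))))
  where
  +-+-interchange : ∀ a b c d → (a + b) + (c + d) ≡ (a + c) + (b + d)
  +-+-interchange = solve-∀

∑-*ˡ : ∀ m c (f : Vec Bool m → ℕ) → ∑ m (λ r → c * f r) ≡ c * ∑ m f
∑-*ˡ zero c f = refl
∑-*ˡ (suc m) c f =
  trans (cong₂ _+_ (∑-*ˡ m c _) (∑-*ˡ m c _)) (sym (*-distribˡ-+ c _ _))

∑-*ʳ : ∀ m c (f : Vec Bool m → ℕ) → ∑ m (λ r → f r * c) ≡ ∑ m f * c
∑-*ʳ m c f = trans (∑-cong m (λ r → *-comm (f r) c)) (trans (∑-*ˡ m c f) (*-comm c _))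

∑-const : ∀ m c → ∑ m (λ _ → c) ≡ 2 ^ m * c
∑-const zero c = sym (+-identityʳ c)
∑-const (suc m) c =
  trans (cong₂ _+_ (∑-const m c) (∑-const m c)) (double (2 ^ m) c)
  where
  double : ∀ a c → a * c + a * c ≡ (2 * a) * c
  double = solve-∀

∑-one : ∀ m → ∑ m (λ _ → 1) ≡ 2 ^ m
∑-one m = trans (∑-const m 1) (*-identityʳ (2 ^ m))

∑-zero : ∀ m → ∑ m (λ _ → 0) ≡ 0
∑-zero m = trans (∑-const m 0) (*-zeroʳ (2 ^ m))

∑-𝟙-≤ : ∀ m (P : Vec Bool m → Bool) → ∑ m (λ r → 𝟙 (P r)) ≤ 2 ^ m
∑-𝟙-≤ m P = ≤-trans (∑-mono-≤ m (λ r → 𝟙≤1 (P r))) (≤-reflexive (∑-one m))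

∑-𝟙+∑-𝟙-not : ∀ m (P : Vec Bool m → Bool) → ∑ m (λ r → 𝟙 (P r)) + ∑ m (λ r → 𝟙 (not (P r))) ≡ 2 ^ m
∑-𝟙+∑-𝟙-not m P =
  trans (sym (∑-distrib-+ m _ _)) (trans (∑-cong m (λ r → 𝟙+𝟙-not (P r))) (∑-one m))

∑-++ : ∀ a b (f : Vec Bool (a + b) → ℕ) → ∑ (a + b) f ≡ ∑ a (λ u → ∑ b (λ v → f (u ++ v)))
∑-++ zero b f = refl
∑-++ (suc a) b f = cong₂ _+_ (∑-++ a b _) (∑-++ a b _)

∑-split : ∀ a b (f : Vec Bool a → Vec Bool b → ℕ) →
  ∑ (a + b) (λ r → f (take a r) (drop a r)) ≡ ∑ a (λ u → ∑ b (λ v → f u v))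
∑-split a b f = trans (∑-++ a b _) (∑-cong a (λ u → ∑-cong b (λ v → cong₂ f (take-++ u v) (drop-++ u v))))

∑-swap : ∀ a b (f : Vec Bool a → Vec Bool b → ℕ) →
  ∑ a (λ u → ∑ b (λ v → f u v)) ≡ ∑ b (λ v → ∑ a (λ u → f u v))
∑-swap zero b f = refl
∑-swap (suc a) b f =
  trans (cong₂ _+_ (∑-swap a b _) (∑-swap a b _)) (sym (∑-distrib-+ b _ _))

∑-product : ∀ a b (f : Vec Bool a → ℕ) (g : Vec Bool b → ℕ) →
  ∑ a (λ u → ∑ b (λ v → f u * g v)) ≡ ∑ a f * ∑ b g
∑-product a b f g = trans (∑-cong a (λ u → ∑-*ˡ b (f u) g)) (∑-*ʳ a (∑ b g) f)

∑-split-product : ∀ a b (f : Vec Bool a → ℕ) (g : Vec Bool b → ℕ) →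
  ∑ (a + b) (λ r → f (take a r) * g (drop a r)) ≡ ∑ a f * ∑ b g
∑-split-product a b f g = trans (∑-split a b (λ u v → f u * g v)) (∑-product a b f g)

∑-square : ∀ m (f : Vec Bool m → ℕ) → ∑ m f * ∑ m f ≡ ∑ m (λ v → ∑ m (λ v′ → f v * f v′))
∑-square m f = sym (∑-product m m f f)

_==_ : ∀ {m} → Vec Bool m → Vec Bool m → Bool
[] == [] = true
(a ∷ v) == (b ∷ w) = (if a then b else not b) ∧ (v == w)

==-refl : ∀ {m} (v : Vec Bool m) → (v == v) ≡ true
==-refl [] = refl
==-refl (false ∷ v) = ==-refl v
==-refl (true ∷ v) = ==-refl v

==-sound : ∀ {m} (v w : Vec Bool m) → (v == w) ≡ true → v ≡ w
==-sound [] [] e = refl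
==-sound (false ∷ v) (false ∷ w) e = cong (false ∷_) (==-sound v w e)
==-sound (true ∷ v) (true ∷ w) e = cong (true ∷_) (==-sound v w e)

∑-δ : ∀ m (w : Vec Bool m) (g : Vec Bool m → ℕ) → ∑ m (λ v → 𝟙 (v == w) * g v) ≡ g w
∑-δ zero [] g = +-identityʳ (g [])
∑-δ (suc m) (false ∷ w) g =
  trans (cong₂ _+_ (∑-δ m w _) (∑-zero m)) (+-identityʳ _)
∑-δ (suc m) (true ∷ w) g = cong₂ _+_ (∑-zero m) (∑-δ m w _)

countTrue≡∑𝟙 : ∀ m (P : Vec Bool m → Bool) → countTrue m P ≡ ∑ m (λ r → 𝟙 (P r))
countTrue≡∑𝟙 zero P with P []
... | true = refl
... | false = refl
countTrue≡∑𝟙 (suc m) P = cong₂ _+_ (countTrue≡∑𝟙 m _) (countTrue≡∑𝟙 m _)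

-- A polynomial over rectangles is a signed sum of rectangle indicators
-- [x ∈ row] · [y ∈ col], kept as the list of its (unmerged) terms.
record Term (X Y : Set) : Set where
  constructor term
  field
    sign : Bool
    row : X → Bool
    col : Y → Bool

Poly : Set → Set → Set
Poly X Y = List (Term X Y)

signed : Bool → ℕ → ℤ
signed true n = ℤ.+ n
signed false n = ℤ.- (ℤ.+ n)

∑ℤ : (m : ℕ) → (Vec Bool m → ℤ) → ℤ
∑ℤ zero f = f []
∑ℤ (suc m) f = ∑ℤ m (λ v → f (false ∷ v)) ℤ.+ ∑ℤ m (λ v → f (true ∷ v))

∑ℤ-cong : ∀ m {f g : Vec Bool m → ℤ} → (∀ r → f r ≡ g r) → ∑ℤ m f ≡ ∑ℤ m g
∑ℤ-cong zero e = e []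
∑ℤ-cong (suc m) e = cong₂ ℤ._+_ (∑ℤ-cong m (λ r → e (false ∷ r))) (∑ℤ-cong m (λ r → e (true ∷ r)))

∑ℤ-+ : ∀ m (f : Vec Bool m → ℕ) → ∑ℤ m (λ v → ℤ.+ f v) ≡ ℤ.+ ∑ m f
∑ℤ-+ zero f = refl
∑ℤ-+ (suc m) f =
  trans (cong₂ ℤ._+_ (∑ℤ-+ m _) (∑ℤ-+ m _)) (sym (ℤₚ.pos-+ (∑ m (λ v → f (false ∷ v))) _))

module _ {X Y : Set} where

  ⟦_⟧ᵗ : Term X Y → X → Y → ℤ
  ⟦ term s a b ⟧ᵗ x y = signed s (𝟙 (a x ∧ b y))

  eval : Poly X Y → X → Y → ℤ
  eval [] x y = 0ℤ
  eval (t ∷ p) x y = ⟦ t ⟧ᵗ x y ℤ.+ eval p x y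

  𝟏 : Poly X Y
  𝟏 = term true (λ _ → true) (λ _ → true) ∷ []

  negate : Poly X Y → Poly X Y
  negate = map λ where (term s a b) → term (not s) a b

  _⊖_ : Poly X Y → Poly X Y → Poly X Y
  p ⊖ q = p ++ᴸ negate q

  _·ᵗ_ : Term X Y → Term X Y → Term X Y
  term s a b ·ᵗ term s′ a′ b′ = term (not (s xor s′)) (λ x → a x ∧ a′ x) (λ y → b y ∧ b′ y)

  _⊗_ : Poly X Y → Poly X Y → Poly X Y
  [] ⊗ q = []
  (t ∷ p) ⊗ q = map (t ·ᵗ_) q ++ᴸ (p ⊗ q)

  restrict : (X → Bool) → Poly X Y → Poly X Y
  restrict g = map λ where (term s a b) → term s (λ x → g x ∧ a x) b

  ∑ᴾ : (m : ℕ) → (Vec Bool m → Poly X Y) → Poly X Y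
  ∑ᴾ zero f = f []
  ∑ᴾ (suc m) f = ∑ᴾ m (λ v → f (false ∷ v)) ++ᴸ ∑ᴾ m (λ v → f (true ∷ v))

  eval-++ : ∀ p q x y → eval (p ++ᴸ q) x y ≡ eval p x y ℤ.+ eval q x y
  eval-++ [] q x y = sym (ℤₚ.+-identityˡ _)
  eval-++ (t ∷ p) q x y =
    trans (cong (λ e → ⟦ t ⟧ᵗ x y ℤ.+ e) (eval-++ p q x y)) (sym (ℤₚ.+-assoc (⟦ t ⟧ᵗ x y) _ _))

  signed-not : ∀ s n → signed (not s) n ≡ ℤ.- signed s n
  signed-not true n = refl
  signed-not false n = sym (ℤₚ.neg-involutive (ℤ.+ n))

  eval-negate : ∀ p x y → eval (negate p) x y ≡ ℤ.- eval p x y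
  eval-negate [] x y = refl
  eval-negate (term s a b ∷ p) x y =
    trans (cong₂ ℤ._+_ (signed-not s _) (eval-negate p x y)) (sym (ℤₚ.neg-distrib-+ (signed s _) _))

  eval-⊖ : ∀ p q x y → eval (p ⊖ q) x y ≡ eval p x y ℤ.- eval q x y
  eval-⊖ p q x y = trans (eval-++ p (negate q) x y) (cong (λ e → eval p x y ℤ.+ e) (eval-negate q x y))

  signed-* : ∀ s s′ m n → signed (not (s xor s′)) (m * n) ≡ signed s m ℤ.* signed s′ n
  signed-* true true m n = ℤₚ.pos-* m n
  signed-* true false m n = trans (cong ℤ.-_ (ℤₚ.pos-* m n)) (ℤₚ.neg-distribʳ-* (ℤ.+ m) (ℤ.+ n))
  signed-* false true m n = trans (cong ℤ.-_ (ℤₚ.pos-* m n)) (ℤₚ.neg-distribˡ-* (ℤ.+ m) (ℤ.+ n))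
  signed-* false false m n = trans (ℤₚ.pos-* m n) (neg-*-neg (ℤ.+ m) (ℤ.+ n))
    where
    neg-*-neg : ∀ i j → i ℤ.* j ≡ ℤ.- i ℤ.* ℤ.- j
    neg-*-neg = ℤ-Solver.solve-∀

  ⟦·ᵗ⟧ : ∀ t t′ x y → ⟦ t ·ᵗ t′ ⟧ᵗ x y ≡ ⟦ t ⟧ᵗ x y ℤ.* ⟦ t′ ⟧ᵗ x y
  ⟦·ᵗ⟧ (term s a b) (term s′ a′ b′) x y =
    trans (cong (signed (not (s xor s′)))
                (trans (cong 𝟙 (∧-interchange (a x) (a′ x) (b y) (b′ y))) (𝟙-∧ (a x ∧ b y) (a′ x ∧ b′ y))))
          (signed-* s s′ _ _)

  eval-map-·ᵗ : ∀ t q x y → eval (map (t ·ᵗ_) q) x y ≡ ⟦ t ⟧ᵗ x y ℤ.* eval q x y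
  eval-map-·ᵗ t [] x y = sym (ℤₚ.*-zeroʳ (⟦ t ⟧ᵗ x y))
  eval-map-·ᵗ t (t′ ∷ q) x y =
    trans (cong₂ ℤ._+_ (⟦·ᵗ⟧ t t′ x y) (eval-map-·ᵗ t q x y))
          (sym (ℤₚ.*-distribˡ-+ (⟦ t ⟧ᵗ x y) _ _))

  eval-⊗ : ∀ p q x y → eval (p ⊗ q) x y ≡ eval p x y ℤ.* eval q x y
  eval-⊗ [] q x y = refl
  eval-⊗ (t ∷ p) q x y =
    trans (eval-++ (map (t ·ᵗ_) q) (p ⊗ q) x y)
          (trans (cong₂ ℤ._+_ (eval-map-·ᵗ t q x y) (eval-⊗ p q x y))
                 (sym (ℤₚ.*-distribʳ-+ (eval q x y) (⟦ t ⟧ᵗ x y) _)))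

  eval-restrict : ∀ g p x y → eval (restrict g p) x y ≡ (if g x then eval p x y else 0ℤ)
  eval-restrict g [] x y with g x
  ... | true = refl
  ... | false = refl
  eval-restrict g (term s a b ∷ p) x y =
    trans (cong (λ e → signed s (𝟙 ((g x ∧ a x) ∧ b y)) ℤ.+ e) (eval-restrict g p x y)) (guard (g x) s)
    where
    guard : ∀ c s → signed s (𝟙 ((c ∧ a x) ∧ b y)) ℤ.+ (if c then eval p x y else 0ℤ)
                    ≡ (if c then signed s (𝟙 (a x ∧ b y)) ℤ.+ eval p x y else 0ℤ)
    guard true s = refl
    guard false true = refl
    guard false false = refl

  eval-∑ᴾ : ∀ m f x y → eval (∑ᴾ m f) x y ≡ ∑ℤ m (λ v → eval (f v) x y)
  eval-∑ᴾ zero f x y = refl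
  eval-∑ᴾ (suc m) f x y =
    trans (eval-++ (∑ᴾ m (λ v → f (false ∷ v))) _ x y) (cong₂ ℤ._+_ (eval-∑ᴾ m _ x y) (eval-∑ᴾ m _ x y))

  length-⊖ : ∀ p q → length (p ⊖ q) ≡ length p + length q
  length-⊖ p q = trans (length-++ p) (cong (length p +_) (length-map _ q))

  length-⊗ : ∀ p q → length (p ⊗ q) ≡ length p * length q
  length-⊗ [] q = refl
  length-⊗ (t ∷ p) q = trans (length-++ (map (t ·ᵗ_) q)) (cong₂ _+_ (length-map _ q) (length-⊗ p q))

  length-∑ᴾ : ∀ m f → length (∑ᴾ m f) ≡ ∑ m (λ v → length (f v))
  length-∑ᴾ zero f = refl
  length-∑ᴾ (suc m) f =
    trans (length-++ (∑ᴾ m (λ v → f (false ∷ v)))) (cong₂ _+_ (length-∑ᴾ m _) (length-∑ᴾ m _))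

reindex : ∀ {X Y X′ Y′} → (X′ → X) → (Y′ → Y) → Poly X Y → Poly X′ Y′
reindex f g = map λ where (term s a b) → term s (a ∘ f) (b ∘ g)

eval-reindex : ∀ {X Y X′ Y′} (f : X′ → X) (g : Y′ → Y) p x y →
  eval (reindex f g p) x y ≡ eval p (f x) (g y)
eval-reindex f g [] x y = refl
eval-reindex f g (term s a b ∷ p) x y = cong (λ e → signed s (𝟙 (a (f x) ∧ b (g y))) ℤ.+ e) (eval-reindex f g p x y)

module _ {X Y : Set} where

  posMass : Poly X Y → X → Y → ℕ
  posMass [] x y = 0
  posMass (term true a b ∷ p) x y = 𝟙 (a x ∧ b y) + posMass p x y
  posMass (term false a b ∷ p) x y = posMass p x y

  negMass : Poly X Y → X → Y → ℕ
  negMass [] x y = 0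
  negMass (term true a b ∷ p) x y = negMass p x y
  negMass (term false a b ∷ p) x y = 𝟙 (a x ∧ b y) + negMass p x y

  eval≡posMass-negMass : ∀ p x y → eval p x y ≡ ℤ.+ posMass p x y ℤ.- ℤ.+ negMass p x y
  eval≡posMass-negMass [] x y = refl
  eval≡posMass-negMass (term true a b ∷ p) x y =
    trans (cong (λ e → ℤ.+ 𝟙 (a x ∧ b y) ℤ.+ e) (eval≡posMass-negMass p x y))
          (trans (add-to-positive (ℤ.+ 𝟙 (a x ∧ b y)) (ℤ.+ posMass p x y) (ℤ.+ negMass p x y))
                 (cong (λ e → e ℤ.- ℤ.+ negMass p x y) (sym (ℤₚ.pos-+ (𝟙 (a x ∧ b y)) _))))
    where
    add-to-positive : ∀ i P N → i ℤ.+ (P ℤ.- N) ≡ (i ℤ.+ P) ℤ.- N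
    add-to-positive = ℤ-Solver.solve-∀
  eval≡posMass-negMass (term false a b ∷ p) x y =
    trans (cong (λ e → ℤ.- ℤ.+ 𝟙 (a x ∧ b y) ℤ.+ e) (eval≡posMass-negMass p x y))
          (trans (add-to-negative (ℤ.+ 𝟙 (a x ∧ b y)) (ℤ.+ posMass p x y) (ℤ.+ negMass p x y))
                 (cong (λ e → ℤ.+ posMass p x y ℤ.- e) (sym (ℤₚ.pos-+ (𝟙 (a x ∧ b y)) _))))
    where
    add-to-negative : ∀ i P N → ℤ.- i ℤ.+ (P ℤ.- N) ≡ P ℤ.- (i ℤ.+ N)
    add-to-negative = ℤ-Solver.solve-∀

  positive : Poly X Y → X → Y → Bool
  positive p x y = negMass p x y <ᵇ posMass p x y

  positive-𝟙 : ∀ p x y b → eval p x y ≡ ℤ.+ 𝟙 b → positive p x y ≡ b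
  positive-𝟙 p x y b e = decide b (mass-gap (trans (sym (eval≡posMass-negMass p x y)) e))
    where
    mass-gap : ℤ.+ posMass p x y ℤ.- ℤ.+ negMass p x y ≡ ℤ.+ 𝟙 b → posMass p x y ≡ 𝟙 b + negMass p x y
    mass-gap e = ℤₚ.+-injective (trans (sub-add (ℤ.+ posMass p x y) (ℤ.+ negMass p x y))
                                       (trans (cong (λ i → i ℤ.+ ℤ.+ negMass p x y) e) (sym (ℤₚ.pos-+ (𝟙 b) _))))
      where
      sub-add : ∀ i j → i ≡ (i ℤ.- j) ℤ.+ j
      sub-add = ℤ-Solver.solve-∀
    n<ᵇn : ∀ n → (n <ᵇ n) ≡ false
    n<ᵇn zero = refl
    n<ᵇn (suc n) = n<ᵇn n
    n<ᵇ1+n : ∀ n → (n <ᵇ suc n) ≡ true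
    n<ᵇ1+n zero = refl
    n<ᵇ1+n (suc n) = n<ᵇ1+n n
    decide : ∀ b → posMass p x y ≡ 𝟙 b + negMass p x y → positive p x y ≡ b
    decide true e = trans (cong (negMass p x y <ᵇ_) e) (n<ᵇ1+n (negMass p x y))
    decide false e = trans (cong (negMass p x y <ᵇ_) e) (n<ᵇn (negMass p x y))

  inRect : (X → Bool) → (Y → Bool) → Protocol X Y
  inRect a b = alice a (leaf false) (bob b (leaf false) (leaf true))

  outRect : (X → Bool) → (Y → Bool) → Protocol X Y
  outRect a b = alice a (leaf true) (bob b (leaf true) (leaf false))

  -- A positive term becomes the guesses [in rectangle] and [true], a
  -- negative one [not in rectangle] and [false]: each term contributes
  -- 1 ± its indicator to the acceptances, out of 2 guesses.
  guesses : Poly X Y → GuessProtocol X Y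
  guesses [] = []
  guesses (term true a b ∷ p) = inRect a b ∷ leaf true ∷ guesses p
  guesses (term false a b ∷ p) = outRect a b ∷ leaf false ∷ guesses p

  length-guesses : ∀ p → length (guesses p) ≡ length p + length p
  length-guesses [] = refl
  length-guesses (term true a b ∷ p) = cong suc (trans (cong suc (length-guesses p)) (sym (+-suc _ _)))
  length-guesses (term false a b ∷ p) = cong suc (trans (cong suc (length-guesses p)) (sym (+-suc _ _)))

  acc-guesses : ∀ p x y → acc (guesses p) x y + negMass p x y ≡ length p + posMass p x y
  acc-guesses [] x y = refl
  acc-guesses (term true a b ∷ p) x y with a x | b y
  ... | true | true = cong suc (trans (cong suc (acc-guesses p x y)) (sym (+-suc (length p) _)))
  ... | true | false = cong suc (acc-guesses p x y)
  ... | false | _ = cong suc (acc-guesses p x y)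
  acc-guesses (term false a b ∷ p) x y with a x | b y
  ... | true | true = trans (+-suc (acc (guesses p) x y) _) (cong suc (acc-guesses p x y))
  ... | true | false = cong suc (acc-guesses p x y)
  ... | false | _ = cong suc (acc-guesses p x y)

  acc≤length : ∀ (Π : GuessProtocol X Y) x y → acc Π x y ≤ length Π
  acc≤length [] x y = z≤n
  acc≤length (q ∷ Π) x y with run q x y
  ... | true = s≤s (acc≤length Π x y)
  ... | false = m≤n⇒m≤1+n (acc≤length Π x y)

  maxDepth-guesses : ∀ p → maxDepth (guesses p) ≤ 2
  maxDepth-guesses [] = z≤n
  maxDepth-guesses (term true a b ∷ p) = ⊔-lub (s≤s (s≤s z≤n)) (⊔-lub z≤n (maxDepth-guesses p))
  maxDepth-guesses (term false a b ∷ p) = ⊔-lub (s≤s (s≤s z≤n)) (⊔-lub z≤n (maxDepth-guesses p))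

l+l∸A<A⇔l<A : ∀ l A → A ≤ l + l → ((l + l) ∸ A < A) ⇔ (l < A)
l+l∸A<A⇔l<A l A A≤2l = mk⇔ to from
  where
  split : (l + l) ∸ A + A ≡ l + l
  split = m∸n+n≡m A≤2l
  to : (l + l) ∸ A < A → l < A
  to d<A with l <? A
  ... | yes l<A = l<A
  ... | no l≮A = contradiction (subst (_< A + A) split (+-monoˡ-< A d<A))
                               (≤⇒≯ (+-mono-≤ (≮⇒≥ l≮A) (≮⇒≥ l≮A)))
  from : l < A → (l + l) ∸ A < A
  from l<A = +-cancelʳ-< A _ A (subst (_< A + A) (sym split) (+-mono-< l<A l<A))

+-balance-<⇔ : ∀ a b c d → a + b ≡ c + d → (c < a ⇔ b < d)
+-balance-<⇔ a b c d e = mk⇔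
  (λ c<a → +-cancelˡ-< c b d (subst (c + b <_) e (+-monoˡ-< b c<a)))
  (λ b<d → +-cancelʳ-< b c a (subst (c + b <_) (sym e) (+-monoʳ-< c b<d)))

guesses-computesPP : ∀ {X Y} (p : Poly X Y) → ComputesPP (guesses p) (positive p)
guesses-computesPP p x y =
  ⇔.trans (⇔.sym Boolₚ.T-≡)
  (⇔.trans (mk⇔ (<ᵇ⇒< _ _) <⇒<ᵇ)
  (⇔.trans (⇔.sym (+-balance-<⇔ (acc (guesses p) x y) (negMass p x y) (length p) (posMass p x y) (acc-guesses p x y)))
  (⇔.trans (⇔.sym (l+l∸A<A⇔l<A (length p) _ acc≤2l))
           (subst (λ N → (N ∸ acc (guesses p) x y < acc (guesses p) x y) ⇔ (rej (guesses p) x y < acc (guesses p) x y))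
                  (length-guesses p) ⇔.refl))))
  where
  acc≤2l : acc (guesses p) x y ≤ length p + length p
  acc≤2l = subst (acc (guesses p) x y ≤_) (length-guesses p) (acc≤length (guesses p) x y)

module _ {X Y X′ Y′ : Set} (f : X′ → X) (g : Y′ → Y) where

  posMass-reindex : ∀ (p : Poly X Y) x y → posMass (reindex f g p) x y ≡ posMass p (f x) (g y)
  posMass-reindex [] x y = refl
  posMass-reindex (term true a b ∷ p) x y = cong (𝟙 (a (f x) ∧ b (g y)) +_) (posMass-reindex p x y)
  posMass-reindex (term false a b ∷ p) x y = posMass-reindex p x y

  negMass-reindex : ∀ (p : Poly X Y) x y → negMass (reindex f g p) x y ≡ negMass p (f x) (g y)
  negMass-reindex [] x y = refl
  negMass-reindex (term true a b ∷ p) x y = negMass-reindex p x y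
  negMass-reindex (term false a b ∷ p) x y = cong (𝟙 (a (f x) ∧ b (g y)) +_) (negMass-reindex p x y)

  positive-reindex : ∀ (p : Poly X Y) x y → positive (reindex f g p) x y ≡ positive p (f x) (g y)
  positive-reindex p x y = cong₂ _<ᵇ_ (negMass-reindex p x y) (posMass-reindex p x y)

_≟ᵛ_ : ∀ {p} (v v′ : Vec Bool p) → Dec (v ≡ v′)
_≟ᵛ_ = ≡-dec Boolₚ._≟_

_·_ : ∀ {p} → Vec Bool p → Vec Bool p → Bool
[] · [] = false
(a ∷ as) · (v ∷ vs) = (a ∧ v) xor (as · vs)

agree : Bool → Bool → Bool
agree b c = not (b xor c)

-- The row (b ∷ a) describes the affine hyperplane a · v = b.
passes : ∀ {p} → Vec Bool (suc p) → Vec Bool p → Bool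
passes (b ∷ a) v = agree b (a · v)

𝟙-agree-false+𝟙-agree-true : ∀ d → 𝟙 (agree false d) + 𝟙 (agree true d) ≡ 1
𝟙-agree-false+𝟙-agree-true true = refl
𝟙-agree-false+𝟙-agree-true false = refl

agree-xor-self : ∀ d c → agree d (c xor d) ≡ not c
agree-xor-self true true = refl
agree-xor-self true false = refl
agree-xor-self false true = refl
agree-xor-self false false = refl

agree-shift : ∀ v₀ v₀′ d d′ c → agree (v₀ xor d) (c xor (v₀′ xor d′)) ≡ agree d ((c xor (v₀ xor v₀′)) xor d′)
agree-shift v₀ v₀′ d d′ c =
  cong not (solve 5 (λ a a′ e e′ f → (a ⊕ e) ⊕ (f ⊕ (a′ ⊕ e′)) ⊜ e ⊕ ((f ⊕ (a ⊕ a′)) ⊕ e′)) refl v₀ v₀′ d d′ c)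
  where
  open import Algebra.Solver.CommutativeMonoid (CommutativeRing.+-commutativeMonoid Boolₚ.xor-∧-commutativeRing)

xor-≢ : ∀ a b → a ≢ b → a xor b ≡ true
xor-≢ true true a≢b = ⊥-elim (a≢b refl)
xor-≢ true false _ = refl
xor-≢ false true _ = refl
xor-≢ false false a≢b = ⊥-elim (a≢b refl)

∑-passes : ∀ p (v : Vec Bool p) → 2 * ∑ (suc p) (λ row → 𝟙 (passes row v)) ≡ 2 ^ suc p
∑-passes p v = cong (2 *_)
  (trans (sym (∑-distrib-+ p (λ a → 𝟙 (agree false (a · v))) (λ a → 𝟙 (agree true (a · v)))))
  (trans (∑-cong p (λ a → 𝟙-agree-false+𝟙-agree-true (a · v))) (∑-one p)))

∑-·-balanced : ∀ p (v v′ : Vec Bool p) → v ≢ v′ → ∀ c →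
  2 * ∑ p (λ a → 𝟙 (agree (a · v) (c xor (a · v′)))) ≡ 2 ^ p
∑-·-balanced zero [] [] v≢v′ c = ⊥-elim (v≢v′ refl)
∑-·-balanced (suc p) (v₀ ∷ v) (v₀′ ∷ v′) v≢v′ c =
  trans (cong (λ s → 2 * (balanced c + s)) shifted) (by-tails (v ≟ᵛ v′))
  where
  balanced : Bool → ℕ
  balanced c = ∑ p (λ a → 𝟙 (agree (a · v) (c xor (a · v′))))
  c′ : Bool
  c′ = c xor (v₀ xor v₀′)
  shifted : ∑ p (λ a → 𝟙 (agree (v₀ xor (a · v)) (c xor (v₀′ xor (a · v′))))) ≡ balanced c′
  shifted = ∑-cong p (λ a → cong 𝟙 (agree-shift v₀ v₀′ (a · v) (a · v′) c))
  by-tails : Dec (v ≡ v′) → 2 * (balanced c + balanced c′) ≡ 2 ^ suc p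
  by-tails (no v≢v′) =
    trans (*-distribˡ-+ 2 (balanced c) (balanced c′))
          (trans (cong₂ _+_ (∑-·-balanced p v v′ v≢v′ c) (∑-·-balanced p v v′ v≢v′ c′))
                 (cong (2 ^ p +_) (sym (+-identityʳ (2 ^ p)))))
  by-tails (yes refl) = cong (2 *_)
    (trans (sym (∑-distrib-+ p _ _))
    (trans (∑-cong p (λ a → cong₂ _+_ (cong 𝟙 (agree-xor-self (a · v) c))
                                      (cong 𝟙 (trans (agree-xor-self (a · v) c′) (cong (λ b → not (c xor b)) v₀≠v₀′)))))
    (trans (∑-cong p (λ _ → 𝟙-not+𝟙-not-flip c)) (∑-one p))))
    where
    v₀≠v₀′ : v₀ xor v₀′ ≡ true
    v₀≠v₀′ = xor-≢ v₀ v₀′ (λ e → v≢v′ (cong (_∷ v) e))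
    𝟙-not+𝟙-not-flip : ∀ c → 𝟙 (not c) + 𝟙 (not (c xor true)) ≡ 1
    𝟙-not+𝟙-not-flip true = refl
    𝟙-not+𝟙-not-flip false = refl

∑-passes-pair : ∀ p (v v′ : Vec Bool p) → v ≢ v′ →
  4 * ∑ (suc p) (λ row → 𝟙 (passes row v ∧ passes row v′)) ≡ 2 ^ suc p
∑-passes-pair p v v′ v≢v′ = begin
    4 * ∑ (suc p) (λ row → 𝟙 (passes row v ∧ passes row v′))
  ≡⟨ *-assoc 2 2 (∑ (suc p) (λ row → 𝟙 (passes row v ∧ passes row v′))) ⟩
    2 * (2 * ∑ (suc p) (λ row → 𝟙 (passes row v ∧ passes row v′)))
  ≡⟨ cong (λ s → 2 * (2 * s)) agreeing ⟩
    2 * (2 * ∑ p (λ a → 𝟙 (agree (a · v) (false xor (a · v′)))))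
  ≡⟨ cong (2 *_) (∑-·-balanced p v v′ v≢v′ false) ⟩
    2 * 2 ^ p
  ∎
  where
  open ≡-Reasoning
  both-agree : ∀ d d′ → 𝟙 (agree false d ∧ agree false d′) + 𝟙 (agree true d ∧ agree true d′) ≡ 𝟙 (agree d (false xor d′))
  both-agree true true = refl
  both-agree true false = refl
  both-agree false true = refl
  both-agree false false = refl
  agreeing : ∑ (suc p) (λ row → 𝟙 (passes row v ∧ passes row v′)) ≡ ∑ p (λ a → 𝟙 (agree (a · v) (false xor (a · v′))))
  agreeing = trans (sym (∑-distrib-+ p (λ a → 𝟙 (agree false (a · v) ∧ agree false (a · v′)))
                                       (λ a → 𝟙 (agree true (a · v) ∧ agree true (a · v′)))))
                   (∑-cong p (λ a → both-agree (a · v) (a · v′)))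

survives : (p j J : ℕ) → Vec Bool (J * suc p) → Vec Bool p → Bool
survives p zero J ρ v = true
survives p (suc j) zero ρ v = true
survives p (suc j) (suc J) ρ v = passes (take (suc p) ρ) v ∧ survives p j J (drop (suc p) ρ) v

∑-𝟙-∧-split : ∀ a b (F : Vec Bool a → Bool) (G : Vec Bool b → Bool) →
  ∑ (a + b) (λ r → 𝟙 (F (take a r) ∧ G (drop a r))) ≡ ∑ a (λ u → 𝟙 (F u)) * ∑ b (λ w → 𝟙 (G w))
∑-𝟙-∧-split a b F G =
  trans (∑-cong (a + b) (λ r → 𝟙-∧ (F (take a r)) (G (drop a r)))) (∑-split-product a b _ _)

∑-survives : ∀ p (v : Vec Bool p) j J → j ≤ J →
  2 ^ j * ∑ (J * suc p) (λ ρ → 𝟙 (survives p j J ρ v)) ≡ 2 ^ (J * suc p)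
∑-survives p v zero J _ = trans (*-identityˡ _) (∑-one (J * suc p))
∑-survives p v (suc j) (suc J) (s≤s j≤J) = begin
    2 ^ suc j * ∑ (suc p + J * suc p) (λ ρ → 𝟙 (survives p (suc j) (suc J) ρ v))
  ≡⟨ cong (2 ^ suc j *_) (∑-𝟙-∧-split (suc p) (J * suc p) (λ u → passes u v) (λ w → survives p j J w v)) ⟩
    (2 * 2 ^ j) * (R * Q)
  ≡⟨ regroup (2 ^ j) R Q ⟩
    (2 * R) * (2 ^ j * Q)
  ≡⟨ cong₂ _*_ (∑-passes p v) (∑-survives p v j J j≤J) ⟩
    2 ^ suc p * 2 ^ (J * suc p)
  ≡⟨ sym (^-distribˡ-+-* 2 (suc p) (J * suc p)) ⟩
    2 ^ (suc p + J * suc p)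
  ∎
  where
  open ≡-Reasoning
  R : ℕ
  R = ∑ (suc p) (λ u → 𝟙 (passes u v))
  Q : ℕ
  Q = ∑ (J * suc p) (λ w → 𝟙 (survives p j J w v))
  regroup : ∀ e R Q → (2 * e) * (R * Q) ≡ (2 * R) * (e * Q)
  regroup = solve-∀

∑-survives-pair : ∀ p (v v′ : Vec Bool p) → v ≢ v′ → ∀ j J → j ≤ J →
  4 ^ j * ∑ (J * suc p) (λ ρ → 𝟙 (survives p j J ρ v ∧ survives p j J ρ v′)) ≡ 2 ^ (J * suc p)
∑-survives-pair p v v′ v≢v′ zero J _ = trans (*-identityˡ _) (∑-one (J * suc p))
∑-survives-pair p v v′ v≢v′ (suc j) (suc J) (s≤s j≤J) = begin
    4 ^ suc j * ∑ (suc p + J * suc p) (λ ρ → 𝟙 (survives p (suc j) (suc J) ρ v ∧ survives p (suc j) (suc J) ρ v′))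
  ≡⟨ cong (4 ^ suc j *_) (trans (∑-cong (suc p + J * suc p) (λ ρ → cong 𝟙 (∧-interchange (passes (take (suc p) ρ) v) (survives p j J (drop (suc p) ρ) v)
                                                                   (passes (take (suc p) ρ) v′) (survives p j J (drop (suc p) ρ) v′))))
       (∑-𝟙-∧-split (suc p) (J * suc p) (λ u → passes u v ∧ passes u v′) (λ w → survives p j J w v ∧ survives p j J w v′))) ⟩
    (4 * 4 ^ j) * (R * Q)
  ≡⟨ regroup (4 ^ j) R Q ⟩
    (4 * R) * (4 ^ j * Q)
  ≡⟨ cong₂ _*_ (∑-passes-pair p v v′ v≢v′) (∑-survives-pair p v v′ v≢v′ j J j≤J) ⟩
    2 ^ suc p * 2 ^ (J * suc p)
  ≡⟨ sym (^-distribˡ-+-* 2 (suc p) (J * suc p)) ⟩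
    2 ^ (suc p + J * suc p)
  ∎
  where
  open ≡-Reasoning
  R : ℕ
  R = ∑ (suc p) (λ u → 𝟙 (passes u v ∧ passes u v′))
  Q : ℕ
  Q = ∑ (J * suc p) (λ w → 𝟙 (survives p j J w v ∧ survives p j J w v′))
  regroup : ∀ e R Q → (4 * e) * (R * Q) ≡ (4 * R) * (e * Q)
  regroup = solve-∀

2*k≤𝟙[k≡1]+k*k : ∀ k → 2 * k ≤ 𝟙 (k ≡ᵇ 1) + k * k
2*k≤𝟙[k≡1]+k*k zero = z≤n
2*k≤𝟙[k≡1]+k*k (suc zero) = s≤s (s≤s z≤n)
2*k≤𝟙[k≡1]+k*k (suc (suc k)) = *-monoˡ-≤ (suc (suc k)) {2} {suc (suc k)} (s≤s (s≤s z≤n))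

-- (w − 2a)(w − 4a) ≤ 0, written with w = 2a + e.
window-quadratic : ∀ a w → 2 * a ≤ w → w ≤ 4 * a → w * w + 8 * (a * a) ≤ 8 * (a * w)
window-quadratic a w 2a≤w w≤4a with m≤n⇒∃[o]m+o≡n 2a≤w
... | e , refl = subst₂ _≤_ (sym (lhs a e)) (rhs a e) (+-monoʳ-≤ (12 * (a * a) + 4 * (a * e)) e²≤)
  where
  lhs : ∀ a e → (2 * a + e) * (2 * a + e) + 8 * (a * a) ≡ (12 * (a * a) + 4 * (a * e)) + e * e
  lhs = solve-∀
  rhs : ∀ a e → (12 * (a * a) + 4 * (a * e)) + (2 * a * e + (2 * (a * e) + 4 * (a * a))) ≡ 8 * (a * (2 * a + e))
  rhs = solve-∀
  4a≡2a+2a : ∀ a → 4 * a ≡ 2 * a + 2 * a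
  4a≡2a+2a = solve-∀
  e≤2a : e ≤ 2 * a
  e≤2a = +-cancelˡ-≤ (2 * a) e (2 * a) (subst (2 * a + e ≤_) (4a≡2a+2a a) w≤4a)
  e²≤ : e * e ≤ 2 * a * e + (2 * (a * e) + 4 * (a * a))
  e²≤ = ≤-trans (*-monoˡ-≤ e e≤2a) (m≤m+n (2 * a * e) _)

-- The counting form of the second-moment method: with S₁ = ∑ K, S₂ = ∑ K²,
-- I = #{K = 1}, first moment a N / w and second moment ≤ N (a² + w a) / w²,
-- at least N / 8 of the N outcomes have K = 1.
moments⇒N≤8*I : ∀ N I S₁ S₂ a w → .{{_ : NonZero w}} →
  2 * S₁ ≤ I + S₂ → w * S₁ ≡ a * N → w * w * S₂ ≤ N * (a * a + w * a) →
  w * w + 8 * (a * a) ≤ 8 * (a * w) → N ≤ 8 * I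
moments⇒N≤8*I N I S₁ S₂ a w pointwise first second window =
  *-cancelʳ-≤ N (8 * I) (w * w) {{m*n≢0 w w}} (+-cancelʳ-≤ (N * (8 * (a * a))) _ _ scaled)
  where
  open ≤-Reasoning
  doubled : w * a * N + w * a * N ≤ (w * w * I + N * (a * a)) + w * a * N
  doubled = begin
      w * a * N + w * a * N
    ≡⟨ e₁ w a N S₁ first ⟩
      w * w * (2 * S₁)
    ≤⟨ *-monoʳ-≤ (w * w) pointwise ⟩
      w * w * (I + S₂)
    ≡⟨ *-distribˡ-+ (w * w) I S₂ ⟩
      w * w * I + w * w * S₂
    ≤⟨ +-monoʳ-≤ (w * w * I) second ⟩
      w * w * I + N * (a * a + w * a)
    ≡⟨ e₂ w a N I ⟩
      (w * w * I + N * (a * a)) + w * a * N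
    ∎
    where
    e₁ : ∀ w a N S₁ → w * S₁ ≡ a * N → w * a * N + w * a * N ≡ w * w * (2 * S₁)
    e₁ w a N S₁ e = trans (sym (reassoc w a N)) (trans (cong (λ t → w * t + w * t) (sym e)) (twice w S₁))
      where
      reassoc : ∀ w a N → w * (a * N) + w * (a * N) ≡ w * a * N + w * a * N
      reassoc = solve-∀
      twice : ∀ w S → w * (w * S) + w * (w * S) ≡ w * w * (2 * S)
      twice = solve-∀
    e₂ : ∀ w a N I → w * w * I + N * (a * a + w * a) ≡ (w * w * I + N * (a * a)) + w * a * N
    e₂ = solve-∀
  single : w * a * N ≤ w * w * I + N * (a * a)
  single = +-cancelʳ-≤ (w * a * N) _ _ doubled
  scaled : N * (w * w) + N * (8 * (a * a)) ≤ 8 * I * (w * w) + N * (8 * (a * a))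
  scaled = begin
      N * (w * w) + N * (8 * (a * a))
    ≡⟨ sym (*-distribˡ-+ N _ _) ⟩
      N * (w * w + 8 * (a * a))
    ≤⟨ *-monoʳ-≤ N window ⟩
      N * (8 * (a * w))
    ≡⟨ e₃ w a N ⟩
      8 * (w * a * N)
    ≤⟨ *-monoʳ-≤ 8 single ⟩
      8 * (w * w * I + N * (a * a))
    ≡⟨ e₄ w a N I ⟩
      8 * I * (w * w) + N * (8 * (a * a))
    ∎
    where
    e₃ : ∀ w a N → N * (8 * (a * w)) ≡ 8 * (w * a * N)
    e₃ = solve-∀
    e₄ : ∀ w a N I → 8 * (w * w * I + N * (a * a)) ≡ 8 * I * (w * w) + N * (8 * (a * a))
    e₄ = solve-∀

4^≡2^*2^ : ∀ j → 4 ^ j ≡ 2 ^ j * 2 ^ j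
4^≡2^*2^ zero = refl
4^≡2^*2^ (suc j) = trans (cong (4 *_) (4^≡2^*2^ j)) (square-double (2 ^ j))
  where
  square-double : ∀ x → 4 * (x * x) ≡ (2 * x) * (2 * x)
  square-double = solve-∀

module Isolation (p j J : ℕ) (j≤J : j ≤ J) (S : Vec Bool p → Bool) where

  M : ℕ
  M = J * suc p
  N : ℕ
  N = 2 ^ M
  w : ℕ
  w = 2 ^ j
  a : ℕ
  a = ∑ p (λ v → 𝟙 (S v))

  surv : Vec Bool M → Vec Bool p → Bool
  surv = survives p j J

  survivors : Vec Bool M → ℕ
  survivors ρ = ∑ p (λ v → 𝟙 (surv ρ v ∧ S v))

  isolated : Vec Bool M → Bool
  isolated ρ = survivors ρ ≡ᵇ 1

  pairs : Vec Bool p → Vec Bool p → ℕ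
  pairs v v′ = ∑ M (λ ρ → 𝟙 (surv ρ v ∧ surv ρ v′))

  first-moment : w * ∑ M survivors ≡ a * N
  first-moment = begin
      w * ∑ M survivors
    ≡⟨ cong (w *_) (trans (∑-cong M (λ ρ → ∑-cong p (λ v → 𝟙-∧ (surv ρ v) (S v))))
         (trans (∑-swap M p (λ ρ v → 𝟙 (surv ρ v) * 𝟙 (S v))) (∑-cong p (λ v → ∑-*ʳ M (𝟙 (S v)) _)))) ⟩
      w * ∑ p (λ v → ∑ M (λ ρ → 𝟙 (surv ρ v)) * 𝟙 (S v))
    ≡⟨ sym (∑-*ˡ p w _) ⟩
      ∑ p (λ v → w * (∑ M (λ ρ → 𝟙 (surv ρ v)) * 𝟙 (S v)))
    ≡⟨ ∑-cong p (λ v → trans (sym (*-assoc w _ (𝟙 (S v)))) (cong (_* 𝟙 (S v)) (∑-survives p v j J j≤J))) ⟩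
      ∑ p (λ v → N * 𝟙 (S v))
    ≡⟨ trans (∑-*ˡ p N _) (*-comm N a) ⟩
      a * N
    ∎
    where open ≡-Reasoning

  pair-bound : ∀ v v′ → w * w * pairs v v′ ≤ N * (1 + w * 𝟙 (v′ == v))
  pair-bound v v′ with v′ == v in eq
  ... | true with ==-sound v′ v eq
  ...   | refl = begin
      w * w * pairs v v
    ≡⟨ trans (*-assoc w w _) (cong (λ c → w * (w * c)) (∑-cong M (λ ρ → cong 𝟙 (Boolₚ.∧-idem (surv ρ v))))) ⟩
      w * (w * ∑ M (λ ρ → 𝟙 (surv ρ v)))
    ≡⟨ cong (w *_) (∑-survives p v j J j≤J) ⟩
      w * N
    ≤⟨ m≤n+m (w * N) N ⟩
      N + w * N
    ≡⟨ e N w ⟩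
      N * (1 + w * 1)
    ∎
    where
    open ≤-Reasoning
    e : ∀ N w → N + w * N ≡ N * (1 + w * 1)
    e = solve-∀
  pair-bound v v′ | false = ≤-reflexive (begin
      w * w * pairs v v′
    ≡⟨ trans (cong (_* pairs v v′) (sym (4^≡2^*2^ j))) (∑-survives-pair p v v′ v≢v′ j J j≤J) ⟩
      N
    ≡⟨ sym (trans (cong (λ c → N * suc c) (*-zeroʳ w)) (*-identityʳ N)) ⟩
      N * (1 + w * 0)
    ∎)
    where
    open ≡-Reasoning
    v≢v′ : v ≢ v′
    v≢v′ refl with trans (sym eq) (==-refl v)
    ... | ()

  second-moment : w * w * ∑ M (λ ρ → survivors ρ * survivors ρ) ≤ N * (a * a + w * a)
  second-moment = begin
      w * w * ∑ M (λ ρ → survivors ρ * survivors ρ)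
    ≡⟨ cong (w * w *_) squares ⟩
      w * w * ∑ p (λ v → ∑ p (λ v′ → s v v′ * pairs v v′))
    ≡⟨ trans (sym (∑-*ˡ p (w * w) _)) (∑-cong p (λ v → trans (sym (∑-*ˡ p (w * w) _))
          (∑-cong p (λ v′ → commute (w * w) (𝟙 (S v)) (𝟙 (S v′)) (pairs v v′))))) ⟩
      ∑ p (λ v → ∑ p (λ v′ → s v v′ * (w * w * pairs v v′)))
    ≤⟨ ∑-mono-≤ p (λ v → ∑-mono-≤ p (λ v′ → *-monoʳ-≤ (s v v′) (pair-bound v v′))) ⟩
      ∑ p (λ v → ∑ p (λ v′ → s v v′ * (N * (1 + w * 𝟙 (v′ == v)))))
    ≡⟨ ∑-cong p inner ⟩
      ∑ p (λ v → N * (𝟙 (S v) * a + w * 𝟙 (S v)))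
    ≡⟨ trans (∑-*ˡ p N _) (cong (N *_) (trans (∑-distrib-+ p _ _)
          (cong₂ _+_ (∑-*ʳ p a (λ v → 𝟙 (S v))) (∑-*ˡ p w (λ v → 𝟙 (S v)))))) ⟩
      N * (a * a + w * a)
    ∎
    where
    open ≤-Reasoning
    s : Vec Bool p → Vec Bool p → ℕ
    s v v′ = 𝟙 (S v) * 𝟙 (S v′)
    commute : ∀ c z z′ P → c * (z * z′ * P) ≡ z * z′ * (c * P)
    commute = solve-∀
    𝟙-∧-∧ : ∀ t z t′ z′ → 𝟙 (t ∧ z) * 𝟙 (t′ ∧ z′) ≡ 𝟙 z * 𝟙 z′ * 𝟙 (t ∧ t′)
    𝟙-∧-∧ t z t′ z′ = trans (sym (𝟙-∧ (t ∧ z) (t′ ∧ z′)))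
      (trans (cong 𝟙 (∧-interchange t z t′ z′)) (trans (𝟙-∧ (t ∧ t′) (z ∧ z′))
      (trans (cong (𝟙 (t ∧ t′) *_) (𝟙-∧ z z′)) (*-comm (𝟙 (t ∧ t′)) _))))
    squares : ∑ M (λ ρ → survivors ρ * survivors ρ) ≡ ∑ p (λ v → ∑ p (λ v′ → s v v′ * pairs v v′))
    squares = trans (∑-cong M (λ ρ → trans (∑-square p (λ v → 𝟙 (surv ρ v ∧ S v)))
                      (∑-cong p (λ v → ∑-cong p (λ v′ → 𝟙-∧-∧ (surv ρ v) (S v) (surv ρ v′) (S v′))))))
              (trans (∑-swap M p _)
                     (∑-cong p (λ v → trans (∑-swap M p _) (∑-cong p (λ v′ → ∑-*ˡ M (s v v′) _)))))
    inner : ∀ v → ∑ p (λ v′ → s v v′ * (N * (1 + w * 𝟙 (v′ == v)))) ≡ N * (𝟙 (S v) * a + w * 𝟙 (S v))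
    inner v = begin-equality
        ∑ p (λ v′ → s v v′ * (N * (1 + w * 𝟙 (v′ == v))))
      ≡⟨ ∑-cong p (λ v′ → expand (𝟙 (S v)) (𝟙 (S v′)) N w (𝟙 (v′ == v))) ⟩
        ∑ p (λ v′ → N * s v v′ + N * w * (𝟙 (v′ == v) * s v v′))
      ≡⟨ ∑-distrib-+ p _ _ ⟩
        ∑ p (λ v′ → N * s v v′) + ∑ p (λ v′ → N * w * (𝟙 (v′ == v) * s v v′))
      ≡⟨ cong₂ _+_ (trans (∑-*ˡ p N _) (cong (N *_) (∑-*ˡ p (𝟙 (S v)) _)))
                   (trans (∑-*ˡ p (N * w) _) (cong (N * w *_) (∑-δ p v (s v)))) ⟩
        N * (𝟙 (S v) * a) + N * w * (𝟙 (S v) * 𝟙 (S v))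
      ≡⟨ cong (λ c → N * (𝟙 (S v) * a) + N * w * c) (𝟙-idem (S v)) ⟩
        N * (𝟙 (S v) * a) + N * w * 𝟙 (S v)
      ≡⟨ collect N (𝟙 (S v)) a w ⟩
        N * (𝟙 (S v) * a + w * 𝟙 (S v))
      ∎
      where
      expand : ∀ z z′ N w e → z * z′ * (N * (1 + w * e)) ≡ N * (z * z′) + N * w * (e * (z * z′))
      expand = solve-∀
      collect : ∀ N z a w → N * (z * a) + N * w * z ≡ N * (z * a + w * z)
      collect = solve-∀

  isolation-likely : 2 * a ≤ w → w ≤ 4 * a → N ≤ 8 * ∑ M (λ ρ → 𝟙 (isolated ρ))
  isolation-likely 2a≤w w≤4a =
    moments⇒N≤8*I N _ (∑ M survivors) _ a w {{m^n≢0 2 j}}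
      (subst₂ _≤_ (∑-*ˡ M 2 survivors) (∑-distrib-+ M _ _) (∑-mono-≤ M (λ ρ → 2*k≤𝟙[k≡1]+k*k (survivors ρ))))
      first-moment second-moment (window-quadratic a w 2a≤w w≤4a)

  isolation-fails-≤ : 2 * a ≤ w → w ≤ 4 * a → 8 * ∑ M (λ ρ → 𝟙 (not (isolated ρ))) ≤ 7 * N
  isolation-fails-≤ 2a≤w w≤4a =
    +-cancelʳ-≤ (8 * I) _ (7 * N) (begin
      8 * ∑ M (λ ρ → 𝟙 (not (isolated ρ))) + 8 * I
    ≡⟨ complement ⟩
      8 * N
    ≡⟨ sym (seven+one N) ⟩
      7 * N + N
    ≤⟨ +-monoʳ-≤ (7 * N) (isolation-likely 2a≤w w≤4a) ⟩
      7 * N + 8 * I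
    ∎)
    where
    open ≤-Reasoning
    I : ℕ
    I = ∑ M (λ ρ → 𝟙 (isolated ρ))
    seven+one : ∀ N → 7 * N + N ≡ 8 * N
    seven+one = solve-∀
    complement : 8 * ∑ M (λ ρ → 𝟙 (not (isolated ρ))) + 8 * I ≡ 8 * N
    complement = trans (sym (*-distribˡ-+ 8 F I)) (cong (8 *_) (trans (+-comm F I) (∑-𝟙+∑-𝟙-not M isolated)))
      where
      F : ℕ
      F = ∑ M (λ ρ → 𝟙 (not (isolated ρ)))

∨-trueʳ : ∀ b → b ∨ true ≡ true
∨-trueʳ true = refl
∨-trueʳ false = refl

not-∨ : ∀ a b → not (a ∨ b) ≡ not a ∧ not b
not-∨ true b = refl
not-∨ false b = refl

power-of-two-window : ∀ q a → 1 ≤ a → a ≤ 2 ^ q → ∃ λ j₀ → j₀ ≤ q × a ≤ 2 ^ j₀ × 2 ^ j₀ ≤ 2 * a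
power-of-two-window zero a 1≤a a≤1 = 0 , z≤n , a≤1 , ≤-trans 1≤a (m≤m+n a _)
power-of-two-window (suc q) a 1≤a a≤2^q+1 with a ≤? 2 ^ q
... | yes a≤2^q =
  let j₀ , j₀≤q , lower , upper = power-of-two-window q a 1≤a a≤2^q
  in j₀ , m≤n⇒m≤1+n j₀≤q , lower , upper
... | no a≰2^q = suc q , ≤-refl , a≤2^q+1 , *-monoʳ-≤ 2 (<⇒≤ (≰⇒> a≰2^q))

narrow : ∀ {p} → (Vec Bool p → Bool) → Vec Bool (suc p) → Vec Bool p → Bool
narrow g row v = g v ∧ passes row v

trialBits : ℕ → ℕ
trialBits p = suc p * suc p

module Trials (p : ℕ) (S : Vec Bool p → Bool) where

  isolates : ∀ J → (Vec Bool p → Bool) → Vec Bool (J * suc p) → Bool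
  isolates zero g ρ = false
  isolates (suc J) g ρ =
    (∑ p (λ v → 𝟙 (narrow g (take (suc p) ρ) v ∧ S v)) ≡ᵇ 1)
    ∨ isolates J (narrow g (take (suc p) ρ)) (drop (suc p) ρ)

  isolated⇒isolates : ∀ j J g ρ → suc j ≤ J →
    (∑ p (λ v → 𝟙 ((g v ∧ survives p (suc j) J ρ v) ∧ S v)) ≡ᵇ 1) ≡ true → isolates J g ρ ≡ true
  isolated⇒isolates zero (suc J) g ρ _ once =
    cong (_∨ isolates J (narrow g row) (drop (suc p) ρ))
      (trans (cong (_≡ᵇ 1) (∑-cong p (λ v → cong (λ c → 𝟙 ((g v ∧ c) ∧ S v))
                                                   (sym (Boolₚ.∧-identityʳ (passes row v))))))
             once)
    where
    row = take (suc p) ρ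
  isolated⇒isolates (suc j) (suc J) g ρ (s≤s j<J) once =
    trans (cong (first ∨_) (isolated⇒isolates j J (narrow g row) (drop (suc p) ρ) j<J
            (trans (cong (_≡ᵇ 1) (∑-cong p (λ v → cong (λ c → 𝟙 (c ∧ S v))
                     (Boolₚ.∧-assoc (g v) (passes row v) (survives p (suc j) J (drop (suc p) ρ) v)))))
                   once)))
          (∨-trueʳ first)
    where
    row = take (suc p) ρ
    first : Bool
    first = ∑ p (λ v → 𝟙 (narrow g row v ∧ S v)) ≡ᵇ 1

  trialIsolates : Vec Bool (trialBits p) → Bool
  trialIsolates = isolates (suc p) (λ _ → true)

  -- Valiant–Vazirani: with a = |S|, the level j₀ + 1 where a ≤ 2^j₀ ≤ 2a
  -- isolates with probability ≥ 1/8.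
  trial-fails-≤ : 1 ≤ ∑ p (λ v → 𝟙 (S v)) →
    8 * ∑ (trialBits p) (λ ρ → 𝟙 (not (trialIsolates ρ))) ≤ 7 * 2 ^ trialBits p
  trial-fails-≤ 1≤a with power-of-two-window p (∑ p (λ v → 𝟙 (S v))) 1≤a (∑-𝟙-≤ p S)
  ... | j₀ , j₀≤p , a≤2^j₀ , 2^j₀≤2a =
    ≤-trans (*-monoʳ-≤ 8 (∑-mono-≤ (trialBits p) (λ ρ →
              contrapositive {Isolation.isolated p (suc j₀) (suc p) (s≤s j₀≤p) S ρ}
                             (isolated⇒isolates j₀ (suc p) (λ _ → true) ρ (s≤s j₀≤p)))))
            (Isolation.isolation-fails-≤ p (suc j₀) (suc p) (s≤s j₀≤p) S
              (*-monoʳ-≤ 2 a≤2^j₀)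
              (subst (2 ^ suc j₀ ≤_) (double-double (∑ p (λ v → 𝟙 (S v)))) (*-monoʳ-≤ 2 2^j₀≤2a)))
    where
    double-double : ∀ a → 2 * (2 * a) ≡ 4 * a
    double-double = solve-∀
    contrapositive : ∀ {b c} → (b ≡ true → c ≡ true) → 𝟙 (not c) ≤ 𝟙 (not b)
    contrapositive {b} {true} _ = z≤n
    contrapositive {true} {false} b⇒c with b⇒c refl
    ... | ()
    contrapositive {false} {false} _ = ≤-refl

  someTrialIsolates : ∀ T → Vec Bool (T * trialBits p) → Bool
  someTrialIsolates zero h = false
  someTrialIsolates (suc T) h =
    trialIsolates (take (trialBits p) h) ∨ someTrialIsolates T (drop (trialBits p) h)

  trials-fail-≤ : 1 ≤ ∑ p (λ v → 𝟙 (S v)) → ∀ T →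
    8 ^ T * ∑ (T * trialBits p) (λ h → 𝟙 (not (someTrialIsolates T h))) ≤ 7 ^ T * 2 ^ (T * trialBits p)
  trials-fail-≤ 1≤a zero = s≤s z≤n
  trials-fail-≤ 1≤a (suc T) = begin
      8 ^ suc T * ∑ (trialBits p + T * trialBits p) (λ h → 𝟙 (not (someTrialIsolates (suc T) h)))
    ≡⟨ cong (8 ^ suc T *_) (trans (∑-cong (trialBits p + T * trialBits p) (λ h →
           cong 𝟙 (not-∨ (trialIsolates (take (trialBits p) h)) (someTrialIsolates T (drop (trialBits p) h)))))
         (∑-𝟙-∧-split (trialBits p) (T * trialBits p) (λ ρ → not (trialIsolates ρ)) (λ h → not (someTrialIsolates T h)))) ⟩
      8 * 8 ^ T * (F₁ * F)
    ≡⟨ regroup (8 ^ T) F₁ F ⟩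
      (8 * F₁) * (8 ^ T * F)
    ≤⟨ *-mono-≤ (trial-fails-≤ 1≤a) (trials-fail-≤ 1≤a T) ⟩
      (7 * 2 ^ trialBits p) * (7 ^ T * 2 ^ (T * trialBits p))
    ≡⟨ trans (regroup′ 7 (2 ^ trialBits p) (7 ^ T) _)
             (cong (7 * 7 ^ T *_) (sym (^-distribˡ-+-* 2 (trialBits p) (T * trialBits p)))) ⟩
      7 ^ suc T * 2 ^ (trialBits p + T * trialBits p)
    ∎
    where
    open ≤-Reasoning
    F₁ : ℕ
    F₁ = ∑ (trialBits p) (λ ρ → 𝟙 (not (trialIsolates ρ)))
    F : ℕ
    F = ∑ (T * trialBits p) (λ h → 𝟙 (not (someTrialIsolates T h)))
    regroup : ∀ e X Y → 8 * e * (X * Y) ≡ (8 * X) * (e * Y)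
    regroup = solve-∀
    regroup′ : ∀ s A B C → (s * A) * (B * C) ≡ s * B * (A * C)
    regroup′ = solve-∀

-- A factor of `trials` vanishes as soon as its prefix of rows isolates one
-- element of S, and every factor is 1 when S is empty.
module OrGate (p : ℕ) where

  selectedSum : (Vec Bool p → Bool) → (Vec Bool p → ℤ) → ℤ
  selectedSum g z = ∑ℤ p (λ v → if g v then z v else 0ℤ)

  sieve : ∀ J → (Vec Bool p → Bool) → Vec Bool (J * suc p) → (Vec Bool p → ℤ) → ℤ
  sieve zero g ρ z = 1ℤ
  sieve (suc J) g ρ z =
    (1ℤ ℤ.- selectedSum (narrow g (take (suc p) ρ)) z) ℤ.* sieve J (narrow g (take (suc p) ρ)) (drop (suc p) ρ) z

  trials : ∀ T′ → Vec Bool (T′ * trialBits p) → (Vec Bool p → ℤ) → ℤ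
  trials zero h z = 1ℤ
  trials (suc T′) h z = sieve (suc p) (λ _ → true) (take (trialBits p) h) z ℤ.* trials T′ (drop (trialBits p) h) z

  sieve-cong : ∀ J g ρ {z z′} → (∀ v → z v ≡ z′ v) → sieve J g ρ z ≡ sieve J g ρ z′
  sieve-cong zero g ρ e = refl
  sieve-cong (suc J) g ρ e =
    cong₂ ℤ._*_ (cong (λ s → 1ℤ ℤ.- s) (∑ℤ-cong p (λ v → cong (if narrow g (take (suc p) ρ) v then_else 0ℤ) (e v))))
                (sieve-cong J _ (drop (suc p) ρ) e)

  trials-cong : ∀ T′ h {z z′} → (∀ v → z v ≡ z′ v) → trials T′ h z ≡ trials T′ h z′
  trials-cong zero h e = refl
  trials-cong (suc T′) h e = cong₂ ℤ._*_ (sieve-cong (suc p) _ (take (trialBits p) h) e) (trials-cong T′ (drop (trialBits p) h) e)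

  module _ (S : Vec Bool p → Bool) where

    open Trials p S using (isolates; trialIsolates; someTrialIsolates)

    bits : Vec Bool p → ℤ
    bits v = ℤ.+ 𝟙 (S v)

    selectedSum-𝟙 : ∀ (g : Vec Bool p → Bool) → selectedSum g bits ≡ ℤ.+ ∑ p (λ v → 𝟙 (g v ∧ S v))
    selectedSum-𝟙 g = trans (∑ℤ-cong p (λ v → select (g v) (S v))) (∑ℤ-+ p _)
      where
      select : ∀ c b → (if c then ℤ.+ 𝟙 b else 0ℤ) ≡ ℤ.+ 𝟙 (c ∧ b)
      select true b = refl
      select false b = refl

    sieve-isolates : ∀ J g ρ → isolates J g ρ ≡ true → sieve J g ρ bits ≡ 0ℤ
    sieve-isolates (suc J) g ρ iso
      with ∑ p (λ v → 𝟙 (narrow g (take (suc p) ρ) v ∧ S v)) ≡ᵇ 1 in once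
    ... | true = cong (λ s → (1ℤ ℤ.- s) ℤ.* sieve J (narrow g (take (suc p) ρ)) (drop (suc p) ρ) bits)
                   (trans (selectedSum-𝟙 _) (cong ℤ.+_ (≡ᵇ⇒≡ _ 1 (Equivalence.from Boolₚ.T-≡ once))))
    ... | false = trans (cong (λ s → factor ℤ.* s) (sieve-isolates J _ (drop (suc p) ρ) iso)) (ℤₚ.*-zeroʳ factor)
      where
      factor : ℤ
      factor = 1ℤ ℤ.- selectedSum (narrow g (take (suc p) ρ)) bits

    trials-isolate : ∀ T′ h → someTrialIsolates T′ h ≡ true → trials T′ h bits ≡ 0ℤ
    trials-isolate (suc T′) h iso with trialIsolates (take (trialBits p) h) in first
    ... | true = cong (ℤ._* trials T′ (drop (trialBits p) h) bits) (sieve-isolates (suc p) _ (take (trialBits p) h) first)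
    ... | false = trans (cong (λ s → factor ℤ.* s) (trials-isolate T′ (drop (trialBits p) h) iso)) (ℤₚ.*-zeroʳ factor)
      where
      factor : ℤ
      factor = sieve (suc p) (λ _ → true) (take (trialBits p) h) bits

    module _ (empty : ∀ v → S v ≡ false) where

      sieve-empty : ∀ J g ρ → sieve J g ρ bits ≡ 1ℤ
      sieve-empty zero g ρ = refl
      sieve-empty (suc J) g ρ =
        cong₂ ℤ._*_ (cong (λ s → 1ℤ ℤ.- s) (trans (selectedSum-𝟙 _) (cong ℤ.+_ nothing-selected)))
                    (sieve-empty J _ (drop (suc p) ρ))
        where
        nothing-selected : ∑ p (λ v → 𝟙 (narrow g (take (suc p) ρ) v ∧ S v)) ≡ 0
        nothing-selected =
          trans (∑-cong p (λ v → cong 𝟙 (trans (cong (narrow g (take (suc p) ρ) v ∧_) (empty v)) (Boolₚ.∧-zeroʳ _))))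
                (∑-zero p)

      trials-empty : ∀ T′ h → trials T′ h bits ≡ 1ℤ
      trials-empty zero h = refl
      trials-empty (suc T′) h =
        cong₂ ℤ._*_ (sieve-empty (suc p) _ (take (trialBits p) h)) (trials-empty T′ (drop (trialBits p) h))

  module _ {X Y : Set} (c : Vec Bool p → Poly X Y) where

    sieveᴾ : ∀ J → (X → Vec Bool p → Bool) → (X → Vec Bool (J * suc p)) → Poly X Y
    sieveᴾ zero g ρ = 𝟏
    sieveᴾ (suc J) g ρ =
      (𝟏 ⊖ ∑ᴾ p (λ v → restrict (λ x → narrow (g x) (take (suc p) (ρ x)) v) (c v)))
      ⊗ sieveᴾ J (λ x → narrow (g x) (take (suc p) (ρ x))) (λ x → drop (suc p) (ρ x))

    trialsᴾ : ∀ T′ → (X → Vec Bool (T′ * trialBits p)) → Poly X Y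
    trialsᴾ zero h = 𝟏
    trialsᴾ (suc T′) h = sieveᴾ (suc p) (λ _ _ → true) (λ x → take (trialBits p) (h x)) ⊗ trialsᴾ T′ (λ x → drop (trialBits p) (h x))

    eval-sieveᴾ : ∀ J g ρ x y → eval (sieveᴾ J g ρ) x y ≡ sieve J (g x) (ρ x) (λ v → eval (c v) x y)
    eval-sieveᴾ zero g ρ x y = refl
    eval-sieveᴾ (suc J) g ρ x y =
      trans (eval-⊗ (𝟏 ⊖ selected) (sieveᴾ J _ (λ x → drop (suc p) (ρ x))) x y)
            (cong₂ ℤ._*_ (trans (eval-⊖ 𝟏 selected x y)
                            (cong (λ s → 1ℤ ℤ.- s) (trans (eval-∑ᴾ p _ x y)
                              (∑ℤ-cong p (λ v → eval-restrict (λ x → narrow (g x) (take (suc p) (ρ x)) v) (c v) x y)))))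
                         (eval-sieveᴾ J _ (λ x → drop (suc p) (ρ x)) x y))
      where
      selected : Poly X Y
      selected = ∑ᴾ p (λ v → restrict (λ x → narrow (g x) (take (suc p) (ρ x)) v) (c v))

    eval-trialsᴾ : ∀ T′ h x y → eval (trialsᴾ T′ h) x y ≡ trials T′ (h x) (λ v → eval (c v) x y)
    eval-trialsᴾ zero h x y = refl
    eval-trialsᴾ (suc T′) h x y =
      trans (eval-⊗ (sieveᴾ (suc p) _ (λ x → take (trialBits p) (h x))) (trialsᴾ T′ (λ x → drop (trialBits p) (h x))) x y)
            (cong₂ ℤ._*_ (eval-sieveᴾ (suc p) _ (λ x → take (trialBits p) (h x)) x y)
                         (eval-trialsᴾ T′ (λ x → drop (trialBits p) (h x)) x y))

anyᵛ : ∀ m → (Vec Bool m → Bool) → Bool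
anyᵛ zero f = f []
anyᵛ (suc m) f = anyᵛ m (λ v → f (false ∷ v)) ∨ anyᵛ m (λ v → f (true ∷ v))

allᵛ : ∀ m → (Vec Bool m → Bool) → Bool
allᵛ zero f = f []
allᵛ (suc m) f = allᵛ m (λ v → f (false ∷ v)) ∧ allᵛ m (λ v → f (true ∷ v))

∨-false : ∀ a b → a ∨ b ≡ false → (a ≡ false) × (b ≡ false)
∨-false false false e = refl , refl

anyᵛ-false : ∀ m f → anyᵛ m f ≡ false → ∀ v → f v ≡ false
anyᵛ-false zero f none [] = none
anyᵛ-false (suc m) f none (false ∷ v) = anyᵛ-false m _ (proj₁ (∨-false _ _ none)) v
anyᵛ-false (suc m) f none (true ∷ v) = anyᵛ-false m _ (proj₂ (∨-false _ _ none)) v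

𝟙-anyᵛ-≤ : ∀ m f → 𝟙 (anyᵛ m f) ≤ ∑ m (λ v → 𝟙 (f v))
𝟙-anyᵛ-≤ zero f = ≤-refl
𝟙-anyᵛ-≤ (suc m) f = ≤-trans (𝟙-∨ (anyᵛ m _) (anyᵛ m _)) (+-mono-≤ (𝟙-anyᵛ-≤ m _) (𝟙-anyᵛ-≤ m _))

allᵛ≡not-anyᵛ-not : ∀ m f → allᵛ m f ≡ not (anyᵛ m (λ v → not (f v)))
allᵛ≡not-anyᵛ-not zero f = sym (Boolₚ.not-involutive (f []))
allᵛ≡not-anyᵛ-not (suc m) f =
  trans (cong₂ _∧_ (allᵛ≡not-anyᵛ-not m _) (allᵛ≡not-anyᵛ-not m _)) (sym (not-∨ (anyᵛ m _) (anyᵛ m _)))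

data Formula (p : ℕ) (X Y : Set) : ℕ → Set where
  rect : ∀ {d} → (X → Bool) → (Y → Bool) → Formula p X Y d
  const : ∀ {d} → Bool → Formula p X Y d
  or : ∀ {d} → (Vec Bool p → Formula p X Y d) → Formula p X Y (suc d)
  and : ∀ {d} → (Vec Bool p → Formula p X Y d) → Formula p X Y (suc d)

module _ {p : ℕ} {X Y : Set} where

  ⟦_⟧ᶠ : ∀ {d} → Formula p X Y d → X → Y → Bool
  ⟦ rect a b ⟧ᶠ x y = a x ∧ b y
  ⟦ const b ⟧ᶠ x y = b
  ⟦ or fs ⟧ᶠ x y = anyᵛ p (λ v → ⟦ fs v ⟧ᶠ x y)
  ⟦ and fs ⟧ᶠ x y = allᵛ p (λ v → ⟦ fs v ⟧ᶠ x y)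

1-𝟙 : ∀ b → 1ℤ ℤ.- ℤ.+ 𝟙 b ≡ ℤ.+ 𝟙 (not b)
1-𝟙 true = refl
1-𝟙 false = refl

-- Each level of a depth-d formula gets its own block of H random bits, shared
-- by the gates of that level; the polynomial reads them on Alice's side.
module Arithmetize (p T : ℕ) {X Y : Set} where

  open OrGate p

  H : ℕ
  H = T * trialBits p

  Random : ℕ → Set
  Random d = Vec Bool (d * H) × X

  dropGate : ∀ {d} → Random (suc d) → Random d
  dropGate (r , x) = drop H r , x

  gateBits : ∀ {d} → Random (suc d) → Vec Bool H
  gateBits (r , x) = take H r

  lift : ∀ {d} → Poly (Random d) Y → Poly (Random (suc d)) Y
  lift {d} = reindex (dropGate {d}) (λ y → y)

  toPoly : ∀ {d} → Formula p X Y d → Poly (Random d) Y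
  toPoly (rect a b) = term true (λ rx → a (proj₂ rx)) b ∷ []
  toPoly (const true) = 𝟏
  toPoly (const false) = []
  toPoly {suc d} (or fs) = 𝟏 ⊖ trialsᴾ (λ v → lift {d} (toPoly (fs v))) T (gateBits {d})
  toPoly {suc d} (and fs) = 𝟏 ⊖ (𝟏 ⊖ trialsᴾ (λ v → 𝟏 ⊖ lift {d} (toPoly (fs v))) T (gateBits {d}))

  gateFails : (Vec Bool p → Bool) → Vec Bool H → Bool
  gateFails S h = anyᵛ p S ∧ not (Trials.someTrialIsolates p S T h)

  fails : ∀ {d} → Formula p X Y d → X → Y → Vec Bool (d * H) → Bool
  fails (rect a b) x y r = false
  fails (const b) x y r = false
  fails (or fs) x y r =
    gateFails (λ v → ⟦ fs v ⟧ᶠ x y) (take H r) ∨ anyᵛ p (λ v → fails (fs v) x y (drop H r))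
  fails (and fs) x y r =
    gateFails (λ v → not (⟦ fs v ⟧ᶠ x y)) (take H r) ∨ anyᵛ p (λ v → fails (fs v) x y (drop H r))

  or-gate : ∀ (S : Vec Bool p → Bool) h → gateFails S h ≡ false → 1ℤ ℤ.- trials T h (bits S) ≡ ℤ.+ 𝟙 (anyᵛ p S)
  or-gate S h ok with anyᵛ p S in any
  ... | false = cong (λ s → 1ℤ ℤ.- s) (trials-empty S (anyᵛ-false p S any) T h)
  ... | true with Trials.someTrialIsolates p S T h in iso
  ...   | true = cong (λ s → 1ℤ ℤ.- s) (trials-isolate S T h iso)
  or-gate S h () | true | false

  toPoly-correct : ∀ {d} (f : Formula p X Y d) x y r → fails f x y r ≡ false →
    eval (toPoly f) (r , x) y ≡ ℤ.+ 𝟙 (⟦ f ⟧ᶠ x y)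
  toPoly-correct (rect a b) x y r ok = ℤₚ.+-identityʳ _
  toPoly-correct (const true) x y r ok = refl
  toPoly-correct (const false) x y r ok = refl
  toPoly-correct {suc d} (or fs) x y r ok = begin
      eval (𝟏 ⊖ trialsᴾ inputs T (gateBits {d})) (r , x) y
    ≡⟨ eval-⊖ 𝟏 (trialsᴾ inputs T (gateBits {d})) (r , x) y ⟩
      1ℤ ℤ.- eval (trialsᴾ inputs T (gateBits {d})) (r , x) y
    ≡⟨ cong (λ s → 1ℤ ℤ.- s) (trans (eval-trialsᴾ inputs T (gateBits {d}) (r , x) y)
                                     (trials-cong T (take H r) input-values)) ⟩
      1ℤ ℤ.- trials T (take H r) (bits (λ v → ⟦ fs v ⟧ᶠ x y))
    ≡⟨ or-gate (λ v → ⟦ fs v ⟧ᶠ x y) (take H r) (proj₁ (∨-false _ _ ok)) ⟩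
      ℤ.+ 𝟙 (⟦ or fs ⟧ᶠ x y)
    ∎
    where
    open ≡-Reasoning
    inputs : Vec Bool p → Poly (Random (suc d)) Y
    inputs = λ v → lift {d} (toPoly (fs v))
    input-values : ∀ v → eval (inputs v) (r , x) y ≡ ℤ.+ 𝟙 (⟦ fs v ⟧ᶠ x y)
    input-values v = trans (eval-reindex (dropGate {d}) (λ y → y) (toPoly (fs v)) (r , x) y)
                           (toPoly-correct (fs v) x y (drop H r) (anyᵛ-false p _ (proj₂ (∨-false _ _ ok)) v))
  toPoly-correct {suc d} (and fs) x y r ok = begin
      eval (𝟏 ⊖ (𝟏 ⊖ trialsᴾ inputs T (gateBits {d}))) (r , x) y
    ≡⟨ eval-⊖ 𝟏 (𝟏 ⊖ trialsᴾ inputs T (gateBits {d})) (r , x) y ⟩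
      1ℤ ℤ.- eval (𝟏 ⊖ trialsᴾ inputs T (gateBits {d})) (r , x) y
    ≡⟨ cong (λ s → 1ℤ ℤ.- s) (trans (eval-⊖ 𝟏 (trialsᴾ inputs T (gateBits {d})) (r , x) y)
         (cong (λ s → 1ℤ ℤ.- s) (trans (eval-trialsᴾ inputs T (gateBits {d}) (r , x) y)
                                        (trials-cong T (take H r) input-values)))) ⟩
      1ℤ ℤ.- (1ℤ ℤ.- trials T (take H r) (bits (λ v → not (⟦ fs v ⟧ᶠ x y))))
    ≡⟨ cong (λ s → 1ℤ ℤ.- s) (or-gate (λ v → not (⟦ fs v ⟧ᶠ x y)) (take H r) (proj₁ (∨-false _ _ ok))) ⟩
      1ℤ ℤ.- ℤ.+ 𝟙 (anyᵛ p (λ v → not (⟦ fs v ⟧ᶠ x y)))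
    ≡⟨ 1-𝟙 _ ⟩
      ℤ.+ 𝟙 (not (anyᵛ p (λ v → not (⟦ fs v ⟧ᶠ x y))))
    ≡⟨ cong (λ b → ℤ.+ 𝟙 b) (sym (allᵛ≡not-anyᵛ-not p (λ v → ⟦ fs v ⟧ᶠ x y))) ⟩
      ℤ.+ 𝟙 (⟦ and fs ⟧ᶠ x y)
    ∎
    where
    open ≡-Reasoning
    inputs : Vec Bool p → Poly (Random (suc d)) Y
    inputs = λ v → 𝟏 ⊖ lift {d} (toPoly (fs v))
    input-values : ∀ v → eval (inputs v) (r , x) y ≡ ℤ.+ 𝟙 (not (⟦ fs v ⟧ᶠ x y))
    input-values v =
      trans (eval-⊖ 𝟏 (lift {d} (toPoly (fs v))) (r , x) y)
            (trans (cong (λ s → 1ℤ ℤ.- s)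
                     (trans (eval-reindex (dropGate {d}) (λ y → y) (toPoly (fs v)) (r , x) y)
                            (toPoly-correct (fs v) x y (drop H r) (anyᵛ-false p _ (proj₂ (∨-false _ _ ok)) v))))
                   (1-𝟙 _))

gateCount : ℕ → ℕ → ℕ
gateCount p zero = 0
gateCount p (suc d) = 1 + 2 ^ p * gateCount p d

gateCount-≤ : ∀ p d → gateCount p d ≤ 2 ^ (d * suc p)
gateCount-≤ p zero = z≤n
gateCount-≤ p (suc d) = begin
    1 + 2 ^ p * gateCount p d
  ≤⟨ +-mono-≤ 1≤2^p*2^dp (*-monoʳ-≤ (2 ^ p) (gateCount-≤ p d)) ⟩
    2 ^ p * 2 ^ (d * suc p) + 2 ^ p * 2 ^ (d * suc p)
  ≡⟨ twice (2 ^ p) (2 ^ (d * suc p)) ⟩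
    2 ^ suc p * 2 ^ (d * suc p)
  ≡⟨ sym (^-distribˡ-+-* 2 (suc p) (d * suc p)) ⟩
    2 ^ (suc p + d * suc p)
  ∎
  where
  open ≤-Reasoning
  1≤2^p*2^dp : 1 ≤ 2 ^ p * 2 ^ (d * suc p)
  1≤2^p*2^dp = *-mono-≤ (m^n>0 2 p) (m^n>0 2 (d * suc p))
  twice : ∀ a b → a * b + a * b ≡ 2 * a * b
  twice = solve-∀

module FailureBound (p T : ℕ) {X Y : Set} where

  open OrGate p
  open Arithmetize p T {X} {Y}

  gateFails-≤ : ∀ S → 8 ^ T * ∑ H (λ h → 𝟙 (gateFails S h)) ≤ 7 ^ T * 2 ^ H
  gateFails-≤ S with anyᵛ p S in any
  ... | true = Trials.trials-fail-≤ p S (≤-trans (≤-reflexive (cong 𝟙 (sym any))) (𝟙-anyᵛ-≤ p S)) T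
  ... | false = ≤-trans (≤-reflexive (trans (cong (8 ^ T *_) (∑-zero H)) (*-zeroʳ (8 ^ T)))) z≤n

  -- union bound over the top gate and the 2ᵖ subformulas
  union-step : ∀ d (S : Vec Bool p → Bool) (sub : Vec Bool p → Vec Bool (d * H) → Bool) →
    (∀ v → 8 ^ T * ∑ (d * H) (λ r → 𝟙 (sub v r)) ≤ gateCount p d * 7 ^ T * 2 ^ (d * H)) →
    8 ^ T * ∑ (H + d * H) (λ r → 𝟙 (gateFails S (take H r) ∨ anyᵛ p (λ v → sub v (drop H r))))
      ≤ gateCount p (suc d) * 7 ^ T * 2 ^ (H + d * H)
  union-step d S sub sub-≤ = begin
      8 ^ T * ∑ (H + d * H) (λ r → 𝟙 (gateFails S (take H r) ∨ anyᵛ p (λ v → sub v (drop H r))))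
    ≤⟨ *-monoʳ-≤ (8 ^ T) (∑-mono-≤ (H + d * H) (λ r →
         ≤-trans (𝟙-∨ (gateFails S (take H r)) _) (+-monoʳ-≤ (𝟙 (gateFails S (take H r))) (𝟙-anyᵛ-≤ p _)))) ⟩
      8 ^ T * ∑ (H + d * H) (λ r → 𝟙 (gateFails S (take H r)) + ∑ p (λ v → 𝟙 (sub v (drop H r))))
    ≡⟨ cong (8 ^ T *_) (trans (∑-split H (d * H) (λ u w → 𝟙 (gateFails S u) + ∑ p (λ v → 𝟙 (sub v w))))
         (trans (∑-cong H (λ u → ∑-distrib-+ (d * H) (λ _ → 𝟙 (gateFails S u)) (λ w → ∑ p (λ v → 𝟙 (sub v w)))))
         (trans (∑-distrib-+ H (λ u → ∑ (d * H) (λ _ → 𝟙 (gateFails S u))) (λ u → ∑ (d * H) (λ w → ∑ p (λ v → 𝟙 (sub v w)))))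
         (cong₂ _+_ (trans (∑-cong H (λ u → trans (∑-const (d * H) _) (*-comm (2 ^ (d * H)) _))) (∑-*ʳ H (2 ^ (d * H)) (λ u → 𝟙 (gateFails S u))))
                    (trans (∑-const H _) (cong (2 ^ H *_) (∑-swap (d * H) p (λ w v → 𝟙 (sub v w))))))))) ⟩
      8 ^ T * (A * 2 ^ (d * H) + 2 ^ H * ∑ p B)
    ≡⟨ trans (distribute (8 ^ T) A (2 ^ (d * H)) (2 ^ H) (∑ p B)) (cong (λ s → (8 ^ T * A) * 2 ^ (d * H) + 2 ^ H * s) (sym (∑-*ˡ p (8 ^ T) B))) ⟩
      (8 ^ T * A) * 2 ^ (d * H) + 2 ^ H * (∑ p (λ v → 8 ^ T * B v))
    ≤⟨ +-mono-≤ (*-monoˡ-≤ (2 ^ (d * H)) (gateFails-≤ S)) (*-monoʳ-≤ (2 ^ H) (∑-mono-≤ p sub-≤)) ⟩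
      (7 ^ T * 2 ^ H) * 2 ^ (d * H) + 2 ^ H * (∑ p (λ v → gateCount p d * 7 ^ T * 2 ^ (d * H)))
    ≡⟨ cong (λ s → (7 ^ T * 2 ^ H) * 2 ^ (d * H) + 2 ^ H * s) (∑-const p _) ⟩
      (7 ^ T * 2 ^ H) * 2 ^ (d * H) + 2 ^ H * (2 ^ p * (gateCount p d * 7 ^ T * 2 ^ (d * H)))
    ≡⟨ collect (7 ^ T) (2 ^ H) (2 ^ (d * H)) (2 ^ p) (gateCount p d) ⟩
      (1 + 2 ^ p * gateCount p d) * 7 ^ T * (2 ^ H * 2 ^ (d * H))
    ≡⟨ cong ((1 + 2 ^ p * gateCount p d) * 7 ^ T *_) (sym (^-distribˡ-+-* 2 H (d * H))) ⟩
      gateCount p (suc d) * 7 ^ T * 2 ^ (H + d * H)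
    ∎
    where
    open ≤-Reasoning
    A : ℕ
    A = ∑ H (λ u → 𝟙 (gateFails S u))
    B : Vec Bool p → ℕ
    B v = ∑ (d * H) (λ w → 𝟙 (sub v w))
    distribute : ∀ e A D E S → e * (A * D + E * S) ≡ (e * A) * D + E * (e * S)
    distribute = solve-∀
    collect : ∀ s E D P g → (s * E) * D + E * (P * (g * s * D)) ≡ (1 + P * g) * s * (E * D)
    collect = solve-∀

  fails-≤ : ∀ {d} (f : Formula p X Y d) x y →
    8 ^ T * ∑ (d * H) (λ r → 𝟙 (fails f x y r)) ≤ gateCount p d * 7 ^ T * 2 ^ (d * H)
  fails-≤ {d} (rect a b) x y = ≤-trans (≤-reflexive (trans (cong (8 ^ T *_) (∑-zero (d * H))) (*-zeroʳ (8 ^ T)))) z≤n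
  fails-≤ {d} (const b) x y = ≤-trans (≤-reflexive (trans (cong (8 ^ T *_) (∑-zero (d * H))) (*-zeroʳ (8 ^ T)))) z≤n
  fails-≤ {suc d} (or fs) x y =
    union-step d (λ v → ⟦ fs v ⟧ᶠ x y) (λ v → fails (fs v) x y) (λ v → fails-≤ (fs v) x y)
  fails-≤ {suc d} (and fs) x y =
    union-step d (λ v → not (⟦ fs v ⟧ᶠ x y)) (λ v → fails (fs v) x y) (λ v → fails-≤ (fs v) x y)

fromBits : ∀ {p} → Vec Bool p → ℕ
fromBits [] = 0
fromBits {suc p} (b ∷ v) = (if b then 2 ^ p else 0) + fromBits v

fromBits-surjective : ∀ p m → m < 2 ^ p → ∃ λ (v : Vec Bool p) → fromBits v ≡ m
fromBits-surjective zero zero _ = [] , refl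
fromBits-surjective zero (suc m) (s≤s ())
fromBits-surjective (suc p) m m<2^p+1 with m <? 2 ^ p
... | yes m<2^p = let v , e = fromBits-surjective p m m<2^p in false ∷ v , e
... | no m≮2^p =
  let v , e = fromBits-surjective p (m ∸ 2 ^ p) (+-cancelˡ-< (2 ^ p) _ _ upper)
  in true ∷ v , trans (cong (2 ^ p +_) e) (m+[n∸m]≡n (≮⇒≥ m≮2^p))
  where
  upper : 2 ^ p + (m ∸ 2 ^ p) < 2 ^ p + 2 ^ p
  upper = subst₂ _<_ (sym (m+[n∸m]≡n (≮⇒≥ m≮2^p))) (cong (2 ^ p +_) (+-identityʳ (2 ^ p))) m<2^p+1

anyᵛ-intro : ∀ m f (v : Vec Bool m) → f v ≡ true → anyᵛ m f ≡ true
anyᵛ-intro zero f [] fv = fv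
anyᵛ-intro (suc m) f (false ∷ v) fv = cong (_∨ anyᵛ m (λ w → f (true ∷ w))) (anyᵛ-intro m _ v fv)
anyᵛ-intro (suc m) f (true ∷ v) fv =
  trans (cong (anyᵛ m (λ w → f (false ∷ w)) ∨_) (anyᵛ-intro m _ v fv)) (∨-trueʳ (anyᵛ m (λ w → f (false ∷ w))))

anyᵛ-elim : ∀ m f → anyᵛ m f ≡ true → ∃ λ v → f v ≡ true
anyᵛ-elim zero f fv = [] , fv
anyᵛ-elim (suc m) f any with anyᵛ m (λ w → f (false ∷ w)) in left
... | true = let v , fv = anyᵛ-elim m _ left in false ∷ v , fv
... | false = let v , fv = anyᵛ-elim m _ any in true ∷ v , fv

allᵛ-intro : ∀ m f → (∀ v → f v ≡ true) → allᵛ m f ≡ true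
allᵛ-intro zero f all = all []
allᵛ-intro (suc m) f all =
  cong₂ _∧_ (allᵛ-intro m _ (λ w → all (false ∷ w))) (allᵛ-intro m _ (λ w → all (true ∷ w)))

∧-true : ∀ a b → a ∧ b ≡ true → (a ≡ true) × (b ≡ true)
∧-true true true e = refl , refl

allᵛ-elim : ∀ m f → allᵛ m f ≡ true → ∀ v → f v ≡ true
allᵛ-elim zero f all [] = all
allᵛ-elim (suc m) f all (false ∷ v) = allᵛ-elim m _ (proj₁ (∧-true _ _ all)) v
allᵛ-elim (suc m) f all (true ∷ v) = allᵛ-elim m _ (proj₂ (∧-true _ _ all)) v

module Alternation (p : ℕ) {X Y : Set} where

  -- the index of 𝔹ᵖ that encodes u : Fin t, or the default d when there is none
  select : ∀ {k} t → Vec Bool p → (Fin t → Formula p X Y k) → Formula p X Y k → Formula p X Y k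
  select t v f d with fromBits v <? t
  ... | yes lt = f (fromℕ< lt)
  ... | no _ = d

  select-hit : ∀ {k} t (v : Vec Bool p) f d (u : Fin t) → fromBits v ≡ toℕ u → select {k} t v f d ≡ f u
  select-hit t v f d u e with fromBits v <? t
  ... | yes lt = cong f (trans (Finₚ.fromℕ<-cong _ _ e lt (Finₚ.toℕ<n u)) (Finₚ.fromℕ<-toℕ u (Finₚ.toℕ<n u)))
  ... | no nlt = contradiction (subst (_< t) (sym e) (Finₚ.toℕ<n u)) nlt

  select-cases : ∀ {k} t (v : Vec Bool p) f d → (∃ λ u → select {k} t v f d ≡ f u) ⊎ (select t v f d ≡ d)
  select-cases t v f d with fromBits v <? t
  ... | yes lt = inj₁ (fromℕ< lt , refl)
  ... | no _ = inj₂ refl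

  alternation : ∀ {k} (ts : Vec ℕ k) → Bool → (Tuple ts → X → Bool) → (Tuple ts → Y → Bool) → Formula p X Y k
  alternation [] b A B = rect (A tt) (B tt)
  alternation (t ∷ ts) true A B =
    or (λ v → select t v (λ u → alternation ts false (λ us → A (u , us)) (λ us → B (u , us))) (const false))
  alternation (t ∷ ts) false A B =
    and (λ v → select t v (λ u → alternation ts true (λ us → A (u , us)) (λ us → B (u , us))) (const true))

  alternation-correct : ∀ {k} (ts : Vec ℕ k) → All (_≤ 2 ^ p) ts → ∀ b A B x y →
    Alt ts b (λ u → A u x ∧ B u y) ⇔ (⟦ alternation ts b A B ⟧ᶠ x y ≡ true)
  alternation-correct [] [] b A B x y = ⇔.refl
  alternation-correct (t ∷ ts) (t≤2^p ∷ ts≤2^p) true A B x y = mk⇔ to from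
    where
    branch : Fin t → Formula p X Y _
    branch u = alternation ts false (λ us → A (u , us)) (λ us → B (u , us))
    IH : ∀ u → Alt ts false (λ us → A (u , us) x ∧ B (u , us) y) ⇔ (⟦ branch u ⟧ᶠ x y ≡ true)
    IH u = alternation-correct ts ts≤2^p false (λ us → A (u , us)) (λ us → B (u , us)) x y
    to : Alt (t ∷ ts) true (λ u → A u x ∧ B u y) → ⟦ alternation (t ∷ ts) true A B ⟧ᶠ x y ≡ true
    to (u , h) with fromBits-surjective p (toℕ u) (≤-trans (Finₚ.toℕ<n u) t≤2^p)
    ... | v , e = anyᵛ-intro p _ v (trans (cong (λ f → ⟦ f ⟧ᶠ x y) (select-hit t v branch (const false) u e))
                                          (Equivalence.to (IH u) h))
    from : ⟦ alternation (t ∷ ts) true A B ⟧ᶠ x y ≡ true → Alt (t ∷ ts) true (λ u → A u x ∧ B u y)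
    from h with anyᵛ-elim p _ h
    ... | v , hv with select-cases t v branch (const false)
    ...   | inj₁ (u , e) = u , Equivalence.from (IH u) (trans (cong (λ f → ⟦ f ⟧ᶠ x y) (sym e)) hv)
    ...   | inj₂ e with trans (cong (λ f → ⟦ f ⟧ᶠ x y) (sym e)) hv
    ...     | ()
  alternation-correct (t ∷ ts) (t≤2^p ∷ ts≤2^p) false A B x y = mk⇔ to from
    where
    branch : Fin t → Formula p X Y _
    branch u = alternation ts true (λ us → A (u , us)) (λ us → B (u , us))
    IH : ∀ u → Alt ts true (λ us → A (u , us) x ∧ B (u , us) y) ⇔ (⟦ branch u ⟧ᶠ x y ≡ true)
    IH u = alternation-correct ts ts≤2^p true (λ us → A (u , us)) (λ us → B (u , us)) x y
    to : Alt (t ∷ ts) false (λ u → A u x ∧ B u y) → ⟦ alternation (t ∷ ts) false A B ⟧ᶠ x y ≡ true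
    to h = allᵛ-intro p _ branch-true
      where
      branch-true : ∀ v → ⟦ select t v branch (const true) ⟧ᶠ x y ≡ true
      branch-true v with select-cases t v branch (const true)
      ... | inj₁ (u , e) = trans (cong (λ f → ⟦ f ⟧ᶠ x y) e) (Equivalence.to (IH u) (h u))
      ... | inj₂ e = cong (λ f → ⟦ f ⟧ᶠ x y) e
    from : ⟦ alternation (t ∷ ts) false A B ⟧ᶠ x y ≡ true → Alt (t ∷ ts) false (λ u → A u x ∧ B u y)
    from h u with fromBits-surjective p (toℕ u) (≤-trans (Finₚ.toℕ<n u) t≤2^p)
    ... | v , e = Equivalence.from (IH u)
                    (trans (cong (λ f → ⟦ f ⟧ᶠ x y) (sym (select-hit t v branch (const true) u e))) (allᵛ-elim p _ h v))

length-restrict : ∀ {X Y : Set} (g : X → Bool) (q : Poly X Y) → length (restrict g q) ≡ length q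
length-restrict g q = length-map _ q

length-reindex : ∀ {X Y X′ Y′ : Set} (f : X′ → X) (g : Y′ → Y) (q : Poly X Y) → length (reindex f g q) ≡ length q
length-reindex f g q = length-map _ q

module _ (p : ℕ) {X Y : Set} (c : Vec Bool p → Poly X Y) (ℓ : ℕ) (c≤ℓ : ∀ v → length (c v) ≤ ℓ) where

  open OrGate p

  length-sieveᴾ : ∀ J g ρ → length (sieveᴾ c J g ρ) ≤ (1 + 2 ^ p * ℓ) ^ J
  length-sieveᴾ zero g ρ = ≤-refl
  length-sieveᴾ (suc J) g ρ = begin
      length ((𝟏 ⊖ selected) ⊗ rest)
    ≡⟨ length-⊗ (𝟏 ⊖ selected) rest ⟩
      length (𝟏 ⊖ selected) * length rest
    ≡⟨ cong (_* length rest) (trans (length-⊖ 𝟏 selected)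
         (cong suc (trans (length-∑ᴾ p _) (∑-cong p (λ v → length-restrict _ (c v)))))) ⟩
      (1 + ∑ p (λ v → length (c v))) * length rest
    ≤⟨ *-mono-≤ (s≤s (≤-trans (∑-mono-≤ p c≤ℓ) (≤-reflexive (∑-const p ℓ)))) (length-sieveᴾ J _ _) ⟩
      (1 + 2 ^ p * ℓ) ^ suc J
    ∎
    where
    open ≤-Reasoning
    selected : Poly X Y
    selected = ∑ᴾ p (λ v → restrict (λ x → narrow (g x) (take (suc p) (ρ x)) v) (c v))
    rest : Poly X Y
    rest = sieveᴾ c J (λ x → narrow (g x) (take (suc p) (ρ x))) (λ x → drop (suc p) (ρ x))

  length-trialsᴾ : ∀ T h → length (trialsᴾ c T h) ≤ (1 + 2 ^ p * ℓ) ^ (T * suc p)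
  length-trialsᴾ zero h = ≤-refl
  length-trialsᴾ (suc T) h = begin
      length (first ⊗ rest)
    ≡⟨ length-⊗ first rest ⟩
      length first * length rest
    ≤⟨ *-mono-≤ (length-sieveᴾ (suc p) (λ _ _ → true) (λ x → take (trialBits p) (h x))) (length-trialsᴾ T _) ⟩
      (1 + 2 ^ p * ℓ) ^ suc p * (1 + 2 ^ p * ℓ) ^ (T * suc p)
    ≡⟨ sym (^-distribˡ-+-* (1 + 2 ^ p * ℓ) (suc p) (T * suc p)) ⟩
      (1 + 2 ^ p * ℓ) ^ (suc T * suc p)
    ∎
    where
    open ≤-Reasoning
    first : Poly X Y
    first = sieveᴾ c (suc p) (λ _ _ → true) (λ x → take (trialBits p) (h x))
    rest : Poly X Y
    rest = trialsᴾ c T (λ x → drop (trialBits p) (h x))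

module Size (p T : ℕ) where

  W : ℕ
  W = T * suc p

  sizeBound : ℕ → ℕ
  sizeBound zero = 1
  sizeBound (suc d) = 2 + (1 + 2 ^ p * (1 + sizeBound d)) ^ W

  1≤sizeBound : ∀ d → 1 ≤ sizeBound d
  1≤sizeBound zero = ≤-refl
  1≤sizeBound (suc d) = s≤s z≤n

  module _ {X Y : Set} where

    open Arithmetize p T {X} {Y}

    length-toPoly : ∀ {d} (f : Formula p X Y d) → length (toPoly f) ≤ sizeBound d
    length-toPoly {d} (rect a b) = 1≤sizeBound d
    length-toPoly {d} (const true) = 1≤sizeBound d
    length-toPoly {d} (const false) = z≤n
    length-toPoly {suc d} (or fs) =
      ≤-trans (≤-reflexive (length-⊖ 𝟏 (OrGate.trialsᴾ p inputs T (gateBits {d}))))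
              (≤-trans (s≤s (length-trialsᴾ p inputs (1 + sizeBound d) inputs≤ T (gateBits {d}))) (n≤1+n _))
      where
      inputs : Vec Bool p → Poly (Random (suc d)) Y
      inputs = λ v → lift {d} (toPoly (fs v))
      inputs≤ : ∀ v → length (inputs v) ≤ 1 + sizeBound d
      inputs≤ v = ≤-trans (≤-reflexive (length-reindex _ _ (toPoly (fs v)))) (≤-trans (length-toPoly (fs v)) (n≤1+n _))
    length-toPoly {suc d} (and fs) =
      ≤-trans (≤-reflexive (trans (length-⊖ 𝟏 (𝟏 ⊖ gate)) (cong suc (length-⊖ 𝟏 gate))))
              (s≤s (s≤s (length-trialsᴾ p inputs (1 + sizeBound d) inputs≤ T (gateBits {d}))))
      where
      inputs : Vec Bool p → Poly (Random (suc d)) Y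
      inputs = λ v → 𝟏 ⊖ lift {d} (toPoly (fs v))
      gate : Poly (Random (suc d)) Y
      gate = OrGate.trialsᴾ p inputs T (gateBits {d})
      inputs≤ : ∀ v → length (inputs v) ≤ 1 + sizeBound d
      inputs≤ v = ≤-trans (≤-reflexive (trans (length-⊖ 𝟏 (lift {d} (toPoly (fs v)))) (cong suc (length-reindex _ _ (toPoly (fs v))))))
                          (s≤s (length-toPoly (fs v)))

  1+2^p*[1+2^E]≤2^[p+E+2] : ∀ E → 1 + 2 ^ p * (1 + 2 ^ E) ≤ 2 ^ (p + E + 2)
  1+2^p*[1+2^E]≤2^[p+E+2] E = begin
      1 + y * (1 + z)
    ≡⟨ expand y z ⟩
      1 + y + y * z
    ≤⟨ +-mono-≤ (+-mono-≤ (*-mono-≤ (m^n>0 2 p) (m^n>0 2 E)) (m≤m*n y z {{m^n≢0 2 E}})) ≤-refl ⟩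
      y * z + y * z + y * z
    ≤⟨ m≤m+n (y * z + y * z + y * z) (y * z) ⟩
      y * z + y * z + y * z + y * z
    ≡⟨ four-times (y * z) ⟩
      y * z * 4
    ≡⟨ sym (trans (^-distribˡ-+-* 2 (p + E) 2) (cong (_* 4) (^-distribˡ-+-* 2 p E))) ⟩
      2 ^ (p + E + 2)
    ∎
    where
    open ≤-Reasoning
    y : ℕ
    y = 2 ^ p
    z : ℕ
    z = 2 ^ E
    expand : ∀ y z → 1 + y * (1 + z) ≡ 1 + y + y * z
    expand = solve-∀
    four-times : ∀ w → w + w + w + w ≡ w * 4
    four-times = solve-∀

  2+2^a≤2^[a+2] : ∀ a → 2 + 2 ^ a ≤ 2 ^ (a + 2)
  2+2^a≤2^[a+2] a = begin
      2 + 2 ^ a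
    ≤⟨ +-monoˡ-≤ (2 ^ a) (+-mono-≤ (m^n>0 2 a) (m^n>0 2 a)) ⟩
      2 ^ a + 2 ^ a + 2 ^ a
    ≤⟨ m≤m+n (2 ^ a + 2 ^ a + 2 ^ a) (2 ^ a) ⟩
      2 ^ a + 2 ^ a + 2 ^ a + 2 ^ a
    ≡⟨ four-times (2 ^ a) ⟩
      2 ^ a * 4
    ≡⟨ sym (^-distribˡ-+-* 2 a 2) ⟩
      2 ^ (a + 2)
    ∎
    where
    open ≤-Reasoning
    four-times : ∀ w → w + w + w + w ≡ w * 4
    four-times = solve-∀

  Q : ℕ
  Q = 3 * (p + 3) * W

  exponent-step : 1 ≤ W → ∀ E → 1 ≤ E → (p + E + 2) * W + 2 ≤ Q * E
  exponent-step 1≤W E 1≤E = begin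
      (p + E + 2) * W + 2
    ≡⟨ regroup p E W ⟩
      (p + 2) * W + E * W + 2
    ≤⟨ +-mono-≤ (+-mono-≤ (≤-trans (*-monoˡ-≤ W (+-monoʳ-≤ p (n≤1+n 2))) bound) E*W≤) 2≤ ⟩
      Z + Z + Z
    ≡⟨ triple p W E ⟩
      Q * E
    ∎
    where
    open ≤-Reasoning
    Z : ℕ
    Z = (p + 3) * W * E
    regroup : ∀ p E W → (p + E + 2) * W + 2 ≡ (p + 2) * W + E * W + 2
    regroup = solve-∀
    triple : ∀ p W E → (p + 3) * W * E + (p + 3) * W * E + (p + 3) * W * E ≡ 3 * (p + 3) * W * E
    triple = solve-∀
    bound : (p + 3) * W ≤ Z
    bound = m≤m*n ((p + 3) * W) E {{>-nonZero 1≤E}}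
    E*W≤ : E * W ≤ Z
    E*W≤ = subst (_≤ Z) (*-comm W E) (*-monoˡ-≤ E (m≤n*m W (p + 3) {{>-nonZero (≤-trans (s≤s z≤n) (m≤n+m 3 p))}}))
    2≤ : 2 ≤ Z
    2≤ = ≤-trans (n≤1+n 2) (*-mono-≤ (*-mono-≤ (m≤n+m 3 p) 1≤W) 1≤E)

  sizeBound-≤ : 1 ≤ T → ∀ d → sizeBound d ≤ 2 ^ (Q ^ suc d)
  sizeBound-≤ 1≤T zero = m^n>0 2 (Q * 1)
  sizeBound-≤ 1≤T (suc d) = begin
      2 + (1 + 2 ^ p * (1 + sizeBound d)) ^ W
    ≤⟨ +-monoʳ-≤ 2 (^-monoˡ-≤ W (+-monoʳ-≤ 1 (*-monoʳ-≤ (2 ^ p) (+-monoʳ-≤ 1 (sizeBound-≤ 1≤T d))))) ⟩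
      2 + (1 + 2 ^ p * (1 + 2 ^ E)) ^ W
    ≤⟨ +-monoʳ-≤ 2 (^-monoˡ-≤ W (1+2^p*[1+2^E]≤2^[p+E+2] E)) ⟩
      2 + (2 ^ (p + E + 2)) ^ W
    ≡⟨ cong (2 +_) (^-*-assoc 2 (p + E + 2) W) ⟩
      2 + 2 ^ ((p + E + 2) * W)
    ≤⟨ 2+2^a≤2^[a+2] ((p + E + 2) * W) ⟩
      2 ^ ((p + E + 2) * W + 2)
    ≤⟨ ^-monoʳ-≤ 2 (exponent-step 1≤W E 1≤E) ⟩
      2 ^ (Q * E)
    ∎
    where
    open ≤-Reasoning
    E : ℕ
    E = Q ^ suc d
    1≤W : 1 ≤ W
    1≤W = *-mono-≤ 1≤T (s≤s z≤n)
    1≤Q : 1 ≤ Q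
    1≤Q = *-mono-≤ (*-mono-≤ {1} {3} {1} {p + 3} (s≤s z≤n) (≤-trans (s≤s z≤n) (m≤n+m 3 p))) 1≤W
    1≤E : 1 ≤ E
    1≤E = m^n>0 Q {{>-nonZero 1≤Q}} (suc d)

^-distribʳ-* : ∀ a b e → (a * b) ^ e ≡ a ^ e * b ^ e
^-distribʳ-* a b zero = refl
^-distribʳ-* a b (suc e) = trans (cong (a * b *_) (^-distribʳ-* a b e)) (interchange a b (a ^ e) (b ^ e))
  where
  interchange : ∀ a b x y → a * b * (x * y) ≡ a * x * (b * y)
  interchange = solve-∀

-- 3 · 2ᵃ · (7/8)ᵀ ≤ 1 for T = 6 (a + 2), because 2 · 7⁶ ≤ 8⁶.
3*2^a*7^T≤8^T : ∀ a → 3 * 2 ^ a * 7 ^ (6 * (a + 2)) ≤ 8 ^ (6 * (a + 2))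
3*2^a*7^T≤8^T a = begin
    3 * 2 ^ a * 7 ^ (6 * (a + 2))
  ≤⟨ *-monoˡ-≤ (7 ^ (6 * (a + 2))) (≤-trans (*-monoˡ-≤ (2 ^ a) (n≤1+n 3))
                                            (≤-reflexive (trans (*-comm 4 (2 ^ a)) (sym (^-distribˡ-+-* 2 a 2))))) ⟩
    2 ^ (a + 2) * 7 ^ (6 * (a + 2))
  ≡⟨ cong (2 ^ (a + 2) *_) (sym (^-*-assoc 7 6 (a + 2))) ⟩
    2 ^ (a + 2) * (7 ^ 6) ^ (a + 2)
  ≡⟨ sym (^-distribʳ-* 2 (7 ^ 6) (a + 2)) ⟩
    (2 * 7 ^ 6) ^ (a + 2)
  ≤⟨ ^-monoˡ-≤ (a + 2) (≤ᵇ⇒≤ (2 * 7 ^ 6) (8 ^ 6) _) ⟩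
    (8 ^ 6) ^ (a + 2)
  ≡⟨ ^-*-assoc 8 6 (a + 2) ⟩
    8 ^ (6 * (a + 2))
  ∎
  where open ≤-Reasoning

module PowersOf (ℓ : ℕ) (2≤ℓ : 2 ≤ ℓ) where

  private
    instance
      ℓ≢0 : NonZero ℓ
      ℓ≢0 = >-nonZero (≤-trans (s≤s z≤n) 2≤ℓ)

  ≤^self : ∀ a → a ≤ ℓ ^ a
  ≤^self a = ≤-trans (<⇒≤ (n<2^n a)) (^-monoˡ-≤ a 2≤ℓ)
    where
    n<2^n : ∀ n → n < 2 ^ n
    n<2^n zero = s≤s z≤n
    n<2^n (suc n) = +-mono-≤ (m^n>0 2 n) (≤-trans (n<2^n n) (m≤m+n (2 ^ n) 0))

  *-≤^ : ∀ {x y i j} → x ≤ ℓ ^ i → y ≤ ℓ ^ j → x * y ≤ ℓ ^ (i + j)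
  *-≤^ {i = i} {j} x≤ y≤ = ≤-trans (*-mono-≤ x≤ y≤) (≤-reflexive (sym (^-distribˡ-+-* ℓ i j)))

  +-≤^ : ∀ {x y i j} → x ≤ ℓ ^ i → y ≤ ℓ ^ j → x + y ≤ ℓ ^ (i + j + 1)
  +-≤^ {x} {y} {i} {j} x≤ y≤ = begin
      x + y
    ≤⟨ +-mono-≤ (≤-trans x≤ (^-monoʳ-≤ ℓ (m≤m+n i j))) (≤-trans y≤ (^-monoʳ-≤ ℓ (m≤n+m j i))) ⟩
      ℓ ^ (i + j) + ℓ ^ (i + j)
    ≤⟨ ≤-trans (≤-reflexive (twice (ℓ ^ (i + j)))) (*-monoʳ-≤ (ℓ ^ (i + j)) 2≤ℓ) ⟩
      ℓ ^ (i + j) * ℓ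
    ≡⟨ sym (trans (^-distribˡ-+-* ℓ (i + j) 1) (cong (ℓ ^ (i + j) *_) (*-identityʳ ℓ))) ⟩
      ℓ ^ (i + j + 1)
    ∎
    where
    open ≤-Reasoning
    twice : ∀ z → z + z ≡ z * 2
    twice = solve-∀

  ^-≤^ : ∀ {x i} e → x ≤ ℓ ^ i → x ^ e ≤ ℓ ^ (i * e)
  ^-≤^ {x} {i} e x≤ = ≤-trans (^-monoˡ-≤ e x≤) (≤-reflexive (^-*-assoc ℓ i e))

⌈log₂[l+l]⌉≤ : ∀ l E → l ≤ 2 ^ E → ⌈log₂ (l + l) ⌉ ≤ E + 1
⌈log₂[l+l]⌉≤ l E l≤2^E =
  ≤-trans (⌈log₂⌉-mono-≤ (≤-trans (+-mono-≤ l≤2^E l≤2^E) (≤-reflexive (twice (2 ^ E)))))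
          (≤-reflexive (trans (cong ⌈log₂_⌉ (sym (^-distribˡ-+-* 2 E 1))) (⌈log₂2^n⌉≡n (E + 1))))
  where
  twice : ∀ z → z + z ≡ z * (2 * 1)
  twice = solve-∀

plog-mono-≤ : ∀ c {a b} → a ≤ b → plog c a ≤ plog c b
plog-mono-≤ c a≤b = ^-monoˡ-≤ c (+-monoʳ-≤ 2 (⌈log₂⌉-mono-≤ a≤b))

dblLen≡ : ∀ n → dblLen n ≡ n + n
dblLen≡ zero = refl
dblLen≡ (suc n) = cong suc (trans (cong suc (dblLen≡ n)) (sym (+-suc n n)))

undouble : ∀ {n} → Vec Bool (dblLen n) → Vec Bool n
undouble {zero} [] = []
undouble {suc n} (a ∷ _ ∷ v) = a ∷ undouble v

undouble-dbl : ∀ {n} (x : Vec Bool n) → undouble (dbl x) ≡ x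
undouble-dbl [] = refl
undouble-dbl (a ∷ x) = cong (a ∷_) (undouble-dbl x)

module Preimage (g : ℕ → ℕ) (g-injective : ∀ a b → g a ≡ g b → a ≡ b) where

  below : (N b : ℕ) → Maybe (∃ λ n → g n ≡ N)
  below N zero = nothing
  below N (suc b) with g b ≟ N
  ... | yes e = just (b , e)
  ... | no _ = below N b

  preimage : ∀ N → Maybe (∃ λ n → g n ≡ N)
  preimage N = below N (suc N)

  below-complete : ∀ N b n (e : g n ≡ N) → n < b → below N b ≡ just (n , e)
  below-complete N (suc b) n e n<1+b with g b ≟ N
  ... | yes e′ = cong just (same-preimage e′ e (g-injective b n (trans e′ (sym e))))
    where
    same-preimage : ∀ {a b} (ea : g a ≡ N) (eb : g b ≡ N) → a ≡ b → (a , ea) ≡ (b , eb)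
    same-preimage ea eb refl = cong (_ ,_) (≡-irrelevant ea eb)
  ... | no g[b]≢N with m≤n⇒m<n∨m≡n (s≤s⁻¹ n<1+b)
  ...   | inj₁ n<b = below-complete N b n e n<b
  ...   | inj₂ refl = ⊥-elim (g[b]≢N e)

  preimage-complete : ∀ n → (∀ n → n ≤ g n) → preimage (g n) ≡ just (n , refl)
  preimage-complete n n≤g = below-complete (g n) (suc (g n)) n refl (s≤s (n≤g n))

module Construction (L : Language) (k : ℕ) (s : ℕ → ℕ) (c : ℕ) (s≤ : ∀ n → s n ≤ 2 ^ plog c n)
  (F : ∀ n → Σ (Vec ℕ k) λ ts → All (_≤ s n) ts ×
             Σ (Tuple ts → Vec Bool n → Bool) λ A → Σ (Tuple ts → Vec Bool n → Bool) λ B →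
             ∀ x y → (L n x y ≡ true) ⇔ Alt ts true (λ u → A u x ∧ B u y)) where

  p : ℕ → ℕ
  p n = plog c n

  trialsAt : ℕ → ℕ
  trialsAt n = 6 * (k * suc (p n) + 2)

  randomBits : ℕ → ℕ
  randomBits n = k * (trialsAt n * trialBits (p n))

  formula : ∀ n → Formula (p n) (Vec Bool n) (Vec Bool n) k
  formula n = let ts , ts≤ , A , B , _ = F n in Alternation.alternation (p n) ts true A B

  ⟦formula⟧ : ∀ n x y → ⟦ formula n ⟧ᶠ x y ≡ L n x y
  ⟦formula⟧ n x y with F n
  ... | ts , ts≤ , A , B , L⇔Alt = Boolₚ.⇔→≡ {z = true}
    (⇔.trans (⇔.sym (Alternation.alternation-correct (p n) ts (All.map (λ t≤ → ≤-trans t≤ (s≤ n)) ts≤) true A B x y))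
             (⇔.sym (L⇔Alt x y)))

  poly : ∀ n → Poly (Vec Bool (randomBits n) × Vec Bool n) (Vec Bool n)
  poly n = Arithmetize.toPoly (p n) (trialsAt n) (formula n)

  -- ⟨x, r⟩ has length paddedLength n for x ∈ 𝔹ⁿ and r ∈ 𝔹^randomBits n
  paddedLength : ℕ → ℕ
  paddedLength n = dblLen n + suc (suc (randomBits n))

  paddedLength-mono-< : ∀ {a b} → a < b → paddedLength a < paddedLength b
  paddedLength-mono-< {a} {b} a<b =
    +-mono-<-≤ (subst₂ _<_ (sym (dblLen≡ a)) (sym (dblLen≡ b)) (+-mono-< a<b a<b))
               (s≤s (s≤s (*-monoʳ-≤ k (*-mono-≤ (*-monoʳ-≤ 6 (+-monoˡ-≤ 2 (*-monoʳ-≤ k (s≤s p-mono))))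
                                                 (*-mono-≤ (s≤s p-mono) (s≤s p-mono))))))
    where
    p-mono : p a ≤ p b
    p-mono = plog-mono-≤ c (<⇒≤ a<b)

  paddedLength-injective : ∀ a b → paddedLength a ≡ paddedLength b → a ≡ b
  paddedLength-injective a b e with <-cmp a b
  ... | tri< a<b _ _ = ⊥-elim (<-irrefl e (paddedLength-mono-< a<b))
  ... | tri≈ _ a≡b _ = a≡b
  ... | tri> _ _ a>b = ⊥-elim (<-irrefl (sym e) (paddedLength-mono-< a>b))

  n≤paddedLength : ∀ n → n ≤ paddedLength n
  n≤paddedLength n = ≤-trans (m≤m+n n n) (≤-trans (≤-reflexive (sym (dblLen≡ n))) (m≤m+n (dblLen n) _))

  open Preimage paddedLength paddedLength-injective

  decodeX : ∀ {N} n → paddedLength n ≡ N → Vec Bool N → Vec Bool (randomBits n) × Vec Bool n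
  decodeX n e x′ = let z = subst (Vec Bool) (sym e) x′ in drop 2 (drop (dblLen n) z) , undouble (take (dblLen n) z)

  decodeY : ∀ {N} n → paddedLength n ≡ N → Vec Bool N → Vec Bool n
  decodeY n e y′ = undouble (take (dblLen n) (subst (Vec Bool) (sym e) y′))

  -- The new language evaluates the sign of the polynomial on the decoded
  -- (x, r) and y; lengths not of the form paddedLength n are rejected.
  L″ : ∀ N → Maybe (∃ λ n → paddedLength n ≡ N) → Vec Bool N → Vec Bool N → Bool
  L″ N nothing x y = false
  L″ N (just (n , e)) x y = positive (poly n) (decodeX n e x) (decodeY n e y)

  L′ : Language
  L′ N = L″ N (preimage N)

  L′-pair : ∀ n (x y : Vec Bool n) r → L′ (paddedLength n) (pair x r) (pair y r) ≡ positive (poly n) (r , x) y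
  L′-pair n x y r =
    trans (cong (λ w → L″ (paddedLength n) w (pair x r) (pair y r)) (preimage-complete n n≤paddedLength))
          (cong₂ (positive (poly n)) (cong₂ _,_ (cong (drop 2) (drop-++ (dbl x) (false ∷ true ∷ r)))
                                                (trans (cong undouble (take-++ (dbl x) (false ∷ true ∷ r))) (undouble-dbl x)))
                                     (trans (cong undouble (take-++ (dbl y) (false ∷ true ∷ r))) (undouble-dbl y)))

  deg-p+1 : ℕ
  deg-p+1 = 0 + c + 1
  deg-T : ℕ
  deg-T = 6 + ((k + deg-p+1) + 2 + 1)
  deg-W : ℕ
  deg-W = deg-T + deg-p+1
  deg-Q : ℕ
  deg-Q = (3 + (c + 3 + 1)) + deg-W
  deg-cost : ℕ
  deg-cost = deg-Q * suc k + 3 + 1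
  deg-random : ℕ
  deg-random = k + (deg-T + (deg-p+1 + deg-p+1))

  module Degrees (n : ℕ) where

    ℓ : ℕ
    ℓ = 2 + ⌈log₂ n ⌉

    open PowersOf ℓ (m≤m+n 2 _)

    p+1≤ : suc (p n) ≤ ℓ ^ deg-p+1
    p+1≤ = +-≤^ {1} {p n} {0} {c} ≤-refl ≤-refl

    T≤ : trialsAt n ≤ ℓ ^ deg-T
    T≤ = *-≤^ {6} {k * suc (p n) + 2} {6} {(k + deg-p+1) + 2 + 1} (≤^self 6)
           (+-≤^ {k * suc (p n)} {2} {k + deg-p+1} {2} (*-≤^ {k} {suc (p n)} {k} {deg-p+1} (≤^self k) p+1≤) (≤^self 2))

    Q≤ : Size.Q (p n) (trialsAt n) ≤ ℓ ^ deg-Q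
    Q≤ = *-≤^ {3 * (p n + 3)} {trialsAt n * suc (p n)} {3 + (c + 3 + 1)} {deg-W}
           (*-≤^ {3} {p n + 3} {3} {c + 3 + 1} (≤^self 3) (+-≤^ {p n} {3} {c} {3} ≤-refl (≤^self 3)))
           (*-≤^ {trialsAt n} {suc (p n)} {deg-T} {deg-p+1} T≤ p+1≤)

    cost≤ : Size.Q (p n) (trialsAt n) ^ suc k + 3 ≤ ℓ ^ deg-cost
    cost≤ = +-≤^ {Size.Q (p n) (trialsAt n) ^ suc k} {3} {deg-Q * suc k} {3} (^-≤^ {Size.Q (p n) (trialsAt n)} {deg-Q} (suc k) Q≤) (≤^self 3)

    random≤ : randomBits n ≤ ℓ ^ deg-random
    random≤ = *-≤^ {k} {trialsAt n * trialBits (p n)} {k} {deg-T + (deg-p+1 + deg-p+1)} (≤^self k)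
                (*-≤^ {trialsAt n} {trialBits (p n)} {deg-T} {deg-p+1 + deg-p+1} T≤
                      (*-≤^ {suc (p n)} {suc (p n)} {deg-p+1} {deg-p+1} p+1≤ p+1≤))

  length-poly : ∀ n → length (poly n) ≤ 2 ^ (Size.Q (p n) (trialsAt n) ^ suc k)
  length-poly n = ≤-trans (Size.length-toPoly (p n) (trialsAt n) (formula n))
                          (Size.sizeBound-≤ (p n) (trialsAt n) (*-mono-≤ {1} {6} (s≤s z≤n) (≤-trans (s≤s z≤n) (m≤n+m 2 (k * suc (p n))))) k)

  guessProtocol : ∀ N (w : Maybe (∃ λ n → paddedLength n ≡ N)) → Σ (GuessProtocol (Vec Bool N) (Vec Bool N)) λ Π →
    ComputesPP Π (L″ N w) × cost Π ≤ plog deg-cost N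
  guessProtocol N nothing = [] , (λ x y → mk⇔ (λ ()) (λ ())) , z≤n
  guessProtocol N (just (n , e)) =
    guesses q , (λ x y → subst (λ b → (b ≡ true) ⇔ (rej (guesses q) x y < acc (guesses q) x y)) (positive-reindex (decodeX n e) (decodeY n e) (poly n) x y)
                                (guesses-computesPP q x y)) ,
    (begin
      ⌈log₂ length (guesses q) ⌉ + maxDepth (guesses q)
    ≤⟨ +-mono-≤ (≤-trans (≤-reflexive (cong ⌈log₂_⌉ length-q)) (⌈log₂[l+l]⌉≤ (length (poly n)) E (length-poly n)))
                (maxDepth-guesses q) ⟩
      E + 1 + 2
    ≡⟨ +-assoc E 1 2 ⟩
      E + 3
    ≤⟨ Degrees.cost≤ n ⟩
      plog deg-cost n
    ≤⟨ plog-mono-≤ deg-cost (subst (n ≤_) e (n≤paddedLength n)) ⟩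
      plog deg-cost N
    ∎)
    where
    open ≤-Reasoning
    q : Poly (Vec Bool N) (Vec Bool N)
    q = reindex (decodeX n e) (decodeY n e) (poly n)
    E : ℕ
    E = Size.Q (p n) (trialsAt n) ^ suc k
    length-q : length (guesses q) ≡ length (poly n) + length (poly n)
    length-q = trans (length-guesses q) (cong₂ _+_ (length-reindex _ _ (poly n)) (length-reindex _ _ (poly n)))

  L′∈PPcc : PPcc L′
  L′∈PPcc = deg-cost , λ N → guessProtocol N (preimage N)

  module Error (n : ℕ) (x y : Vec Bool n) where

    open Arithmetize (p n) (trialsAt n) {Vec Bool n} {Vec Bool n} using (fails; toPoly-correct)

    N : ℕ
    N = 2 ^ randomBits n
    T : ℕ
    T = trialsAt n

    failures : ℕ
    failures = ∑ (randomBits n) (λ r → 𝟙 (fails (formula n) x y r))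

    3*failures≤N : 3 * failures ≤ N
    3*failures≤N = *-cancelˡ-≤ (8 ^ T) {{m^n≢0 8 T}} (begin
        8 ^ T * (3 * failures)
      ≡⟨ *-comm3 (8 ^ T) 3 failures ⟩
        3 * (8 ^ T * failures)
      ≤⟨ *-monoʳ-≤ 3 (FailureBound.fails-≤ (p n) T (formula n) x y) ⟩
        3 * (gateCount (p n) k * 7 ^ T * N)
      ≤⟨ *-monoʳ-≤ 3 (*-monoˡ-≤ N (*-monoˡ-≤ (7 ^ T) (gateCount-≤ (p n) k))) ⟩
        3 * (2 ^ (k * suc (p n)) * 7 ^ T * N)
      ≡⟨ *-assoc4 (2 ^ (k * suc (p n))) (7 ^ T) N ⟩
        3 * 2 ^ (k * suc (p n)) * 7 ^ T * N
      ≤⟨ *-monoˡ-≤ N (3*2^a*7^T≤8^T (k * suc (p n))) ⟩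
        8 ^ T * N
      ∎)
      where
      open ≤-Reasoning
      *-comm3 : ∀ e t B → e * (t * B) ≡ t * (e * B)
      *-comm3 = solve-∀
      *-assoc4 : ∀ a b N → 3 * (a * b * N) ≡ 3 * a * b * N
      *-assoc4 = solve-∀

    accepted : Vec Bool (randomBits n) → Bool
    accepted r = positive (poly n) (r , x) y

    accepted-correct : ∀ r → fails (formula n) x y r ≡ false → accepted r ≡ L n x y
    accepted-correct r ok =
      trans (positive-𝟙 (poly n) (r , x) y _ (toPoly-correct (formula n) x y r ok)) (⟦formula⟧ n x y)

    count≡ : countTrue (randomBits n) (λ r → L′ _ (pair x r) (pair y r)) ≡ ∑ (randomBits n) (λ r → 𝟙 (accepted r))
    count≡ = trans (countTrue≡∑𝟙 (randomBits n) _) (∑-cong (randomBits n) (λ r → cong 𝟙 (L′-pair n x y r)))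

    rejects : L n x y ≡ false → 3 * countTrue (randomBits n) (λ r → L′ _ (pair x r) (pair y r)) ≤ N
    rejects L≡false =
      ≤-trans (≤-reflexive (cong (3 *_) count≡)) (≤-trans (*-monoʳ-≤ 3 (∑-mono-≤ (randomBits n) wrong≤fails)) 3*failures≤N)
      where
      wrong≤fails : ∀ r → 𝟙 (accepted r) ≤ 𝟙 (fails (formula n) x y r)
      wrong≤fails r with fails (formula n) x y r in fr
      ... | true = 𝟙≤1 (accepted r)
      ... | false = ≤-reflexive (cong 𝟙 (trans (accepted-correct r fr) L≡false))

    accepts : L n x y ≡ true → 2 * N ≤ 3 * countTrue (randomBits n) (λ r → L′ _ (pair x r) (pair y r))
    accepts L≡true = subst (2 * N ≤_) (sym (cong (3 *_) count≡)) (+-cancelʳ-≤ (3 * failures) (2 * N) (3 * A) (begin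
        2 * N + 3 * failures
      ≤⟨ +-monoʳ-≤ (2 * N) 3*failures≤N ⟩
        2 * N + N
      ≡⟨ three-times N ⟩
        3 * N
      ≤⟨ *-monoʳ-≤ 3 N≤A+failures ⟩
        3 * (A + failures)
      ≡⟨ *-distribˡ-+ 3 A failures ⟩
        3 * A + 3 * failures
      ∎))
      where
      open ≤-Reasoning
      A : ℕ
      A = ∑ (randomBits n) (λ r → 𝟙 (accepted r))
      three-times : ∀ N → 2 * N + N ≡ 3 * N
      three-times = solve-∀
      right+fails : ∀ r → 1 ≤ 𝟙 (accepted r) + 𝟙 (fails (formula n) x y r)
      right+fails r with fails (formula n) x y r in fr
      ... | true = m≤n+m 1 (𝟙 (accepted r))
      ... | false = ≤-reflexive (trans (cong 𝟙 (sym (trans (accepted-correct r fr) L≡true))) (sym (+-identityʳ _)))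
      N≤A+failures : N ≤ A + failures
      N≤A+failures = ≤-trans (≤-reflexive (sym (∑-one (randomBits n))))
                             (≤-trans (∑-mono-≤ (randomBits n) right+fails) (≤-reflexive (∑-distrib-+ (randomBits n) _ _)))

theorem15 : ∀ (L : Language) → PHcc L → BP PPcc L
theorem15 L (k , s , (c , s≤) , F) =
  L′ , L′∈PPcc , randomBits , (deg-random , Degrees.random≤) , λ n x y → Error.rejects n x y , Error.accepts n x y
  where open Construction L k s c s≤ F
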